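{- Let $G=\mathrm{SL}_n$, $k=n-1$, fix $m\in[k]$, put $r=n-m$, and let $P$ be the maximal parabolic with $\Delta_P=\Delta\setminus\{\alpha_m\}$. Fix an integer $d$ with $0\le d\le\min\{m,r\}$, and let $\gamma_{\mathbf d_B}=\sum_i (\mathbf d_B)_i\alpha_i^\vee\in Q^\vee$ be the unique element with $\gamma_{\mathbf d_B}\equiv d\,\alpha_m^\vee \pmod{Q_P^\vee}$ and $\langle\gamma_{\mathbf d_B},\alpha\rangle\in\{0,-1\}$ for all $\alpha\in R_P^+$. Then $$\mathbf d_B=(0^{m-d},1,2,\dots,d-1,d,d-1,\dots,2,1,0^{r-d}).$$ Moreover, the set $\Delta_{P'_d}:=\{\alpha\in\Delta_P:\langle\gamma_{\mathbf d_B},\alpha\rangle=0\}$ equals $\Delta\setminus\{\alpha_{m-d},\alpha_m,\alpha_{m+d}\}$, and the longest element of the corresponding parabolic subgroup $W_{P'_d}$ of $S_n$ is $$w_0^{P'_d}=w_0^{P_{1,m-d-1}}\cdot w_0^{P_{m-d+1,m-1}}\cdot w_0^{P_{m+1,m+d-1}}\cdot w_0^{P_{m+d+1,k}}.$$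
   Context: Type $A_k$ root data: simple roots $\alpha_i=e_i-e_{i+1}$ ($i\in[k]$) in $\{v\in\mathbb R^n:\sum v_i=0\}$, coroots $\alpha_i^\vee=e_i-e_{i+1}$, pairing $\langle\cdot,\cdot\rangle$ the standard Euclidean inner product; $\Delta=\{\alpha_1,\dots,\alpha_k\}$; $Q^\vee=\bigoplus_i\mathbb Z\alpha_i^\vee$, $Q_P^\vee=\bigoplus_{\alpha_i\in\Delta_P}\mathbb Z\alpha_i^\vee$; $R_P^+$ is the set of positive roots that are nonnegative combinations of $\Delta_P$. (Existence and uniqueness of $\gamma_{\mathbf d_B}$ is a known theorem of Woodward/Peterson.) Simple roots with index outside $[k]$ (i.e. $\alpha_0$, $\alpha_n$) are simply absent. For $i\le j$, $W_{P_{ij}}=\langle s_i,\dots,s_j\rangle\subseteq S_n$, with longest element $w_0^{P_{ij}}=[1\cdots i-1\mid j+1\,j\cdots i\mid j+2\cdots n]$ in one-line notation; if $i>j$ it is trivial and $w_0^{P_{ij}}$ is the identity. -}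

module Defs where

open import Data.Nat as ℕ using (ℕ; zero; suc; _+_; _∸_; _≤_; _<_; _≤ᵇ_; _≡ᵇ_; ∣_-_∣)
open import Data.Integer as ℤ using (ℤ; +_; -[1+_]; 0ℤ)
open import Data.Bool using (Bool; true; false; if_then_else_; _∧_)
open import Data.List using (List; []; _∷_)
open import Data.List.Relation.Unary.All using (All)
open import Data.Product using (Σ; _×_; _,_; ∃)
open import Data.Sum using (_⊎_)
open import Relation.Binary.PropositionalEquality using (_≡_; _≢_)
open import Relation.Nullary using (does)

-- Conventions: everything is 1-based, as in the paper.
--   * vectors of ℝ^n with integer entries (all roots/coroots/Q^∨ are integral)
--     are functions ℕ → ℤ whose coordinates 1..n are the meaningful ones;
--   * elements of Q^∨ are given by coefficient functions c : ℕ → ℤ,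
--     γ = Σ_{i=1}^{k} c i · α_i^∨ (values outside [1,k] are ignored);
--   * elements of S_n are permutations ℕ → ℕ in one-line notation
--     (p ↦ w p), fixing every point outside [1,n].

sumℤ : ℕ → (ℕ → ℤ) → ℤ
sumℤ zero    f = 0ℤ
sumℤ (suc N) f = sumℤ N f ℤ.+ f (suc N)

sumℕ : ℕ → (ℕ → ℕ) → ℕ
sumℕ zero    f = 0
sumℕ (suc N) f = sumℕ N f + f (suc N)

e : ℕ → ℕ → ℤ
e a j = if a ≡ᵇ j then + 1 else 0ℤ

simpleRoot : ℕ → ℕ → ℤ
simpleRoot i j = e i j ℤ.- e (suc i) j

coroot : ℕ → ℕ → ℤ
coroot i j = e i j ℤ.- e (suc i) j

pairing : (n : ℕ) → (ℕ → ℤ) → (ℕ → ℤ) → ℤ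
pairing n u v = sumℤ n (λ j → u j ℤ.* v j)

corootVec : (n : ℕ) → (ℕ → ℤ) → ℕ → ℤ
corootVec n c j = sumℤ (n ∸ 1) (λ i → c i ℤ.* coroot i j)

_≈[_]_ : (ℕ → ℤ) → ℕ → (ℕ → ℤ) → Set
u ≈[ n ] v = ∀ j → 1 ≤ j → j ≤ n → u j ≡ v j

-- R_P^+ (for Δ_P = Δ ∖ {α_m}): positive roots that are nonnegative
-- integer combinations of Δ_P, i.e. Σ_{i=1}^{k} c_i α_i with c_i ≥ 0, c_m = 0.
NonnegCombΔP : (n m : ℕ) → (ℕ → ℤ) → Set
NonnegCombΔP n m α =
  Σ (ℕ → ℕ) λ c → (c m ≡ 0) ×
    (α ≈[ n ] (λ j → sumℤ (n ∸ 1) (λ i → + c i ℤ.* simpleRoot i j)))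

InRPplus : (n m : ℕ) → (ℕ → ℤ) → Set
InRPplus n m α =
  Σ ℕ λ a → Σ ℕ λ b → (1 ≤ a) × (a < b) × (b ≤ n) ×
    (α ≈[ n ] (λ j → e a j ℤ.- e b j)) × NonnegCombΔP n m α

-- γ ≡ d α_m^∨ (mod Q_P^∨), for γ = Σ c_i α_i^∨:
-- γ = d α_m^∨ + q with q ∈ Q_P^∨ = ⊕_{i ≠ m} ℤ α_i^∨.
CongModQP : (n m d : ℕ) → (ℕ → ℤ) → Set
CongModQP n m d c =
  Σ (ℕ → ℤ) λ q → (q m ≡ 0ℤ) ×
    (∀ i → 1 ≤ i → i ≤ n ∸ 1 →
       c i ≡ (if i ≡ᵇ m then + d else 0ℤ) ℤ.+ q i)

IsGammaDB : (n m d : ℕ) → (ℕ → ℤ) → Set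
IsGammaDB n m d c =
  CongModQP n m d c ×
  (∀ α → InRPplus n m α →
     (pairing n (corootVec n c) α ≡ 0ℤ) ⊎ (pairing n (corootVec n c) α ≡ -[1+ 0 ]))

-- The explicit tuple (0^{m-d},1,2,…,d-1,d,d-1,…,1,0^{r-d}):
-- its i-th entry (1 ≤ i ≤ k) is max(0, d - |i - m|).
dBexplicit : (m d : ℕ) → ℕ → ℤ
dBexplicit m d i = + (d ∸ ∣ i - m ∣)

InΔP' : (n m : ℕ) → (ℕ → ℤ) → ℕ → Set
InΔP' n m c i =
  (1 ≤ i) × (i ≤ n ∸ 1) × (i ≢ m) × (pairing n (corootVec n c) (simpleRoot i) ≡ 0ℤ)

-- Symmetric group S_n, permutations in one-line notation, product w·v = w ∘ v.
Perm : Set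
Perm = ℕ → ℕ

_·_ : Perm → Perm → Perm
(w · v) x = w (v x)

idP : Perm
idP x = x

s : ℕ → Perm
s i x = if x ≡ᵇ i then suc i else (if x ≡ᵇ suc i then i else x)

prodS : List ℕ → Perm
prodS []       = idP
prodS (i ∷ is) = s i · prodS is

-- Equality in S_n (all our permutations fix the complement of [1,n])
_≗P_ : Perm → Perm → Set
w ≗P v = ∀ x → w x ≡ v x

InW : (ℕ → Set) → Perm → Set
InW J w = Σ (List ℕ) λ is → All J is × (w ≗P prodS is)

len : ℕ → Perm → ℕ
len n w = sumℕ n (λ b → sumℕ (b ∸ 1) (λ a → if does (w b ℕ.<? w a) then 1 else 0))

IsLongest : ℕ → (ℕ → Set) → Perm → Set
IsLongest n J w = InW J w × (∀ v → InW J v → len n v ≤ len n w)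

-- w_0^{P_{ij}} = [1 ⋯ i-1 | j+1 j ⋯ i | j+2 ⋯ n]; identity if i > j.
w0P : ℕ → ℕ → Perm
w0P i j x = if (i ≤ᵇ j) ∧ (i ≤ᵇ x) ∧ (x ≤ᵇ suc j) then (i + suc j) ∸ x else x

module Submission where

open import Defs
open import Data.Nat using (ℕ; _+_; _∸_; _≤_)
open import Data.Product using (_×_)
open import Relation.Binary.PropositionalEquality using (_≡_; _≢_)
open import Function.Bundles using (_⇔_)

open import Data.Nat as ℕ using (zero; suc; pred; _<_; _≤ᵇ_; _<ᵇ_; _≡ᵇ_; z≤n; s≤s; _≤?_; _<?_; _≟_; ∣_-_∣)
import Data.Nat.Properties as ℕP
import Data.Nat.Tactic.RingSolver as ℕSolver
open import Data.Integer as ℤ using (ℤ; +_; -[1+_]; 0ℤ; +≤+)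
import Data.Integer.Properties as ℤP
open import Data.Integer.Tactic.RingSolver using (solve-∀)
open import Data.Bool using (true; false; if_then_else_; _∧_)
open import Data.Empty using (⊥-elim)
open import Data.List using (List; []; _∷_; _++_)
open import Data.List.Relation.Unary.All as All using (All; []; _∷_)
open import Data.List.Relation.Unary.All.Properties using (++⁺)
open import Data.Product using (Σ; _,_; proj₁; proj₂)
open import Data.Sum using (_⊎_; inj₁; inj₂)
open import Function.Bundles using (mk⇔; Equivalence)
open import Relation.Binary.PropositionalEquality using (refl; sym; trans; cong; cong₂; subst; subst₂; module ≡-Reasoning)
open import Relation.Binary.Definitions using (tri<; tri≈; tri>)
open import Relation.Nullary using (¬_; Dec; yes; no; does)
open import Relation.Nullary.Decidable using (dec-true; dec-false)

-- The j-th coordinate of Σ c_i (e_i - e_{i+1}) is c_j - c_{j-1}.  By telescoping, R_P^+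
-- consists of the e_a - e_b (a < b) with a, b on the same side of m, so the root condition
-- on γ reads: γ_a - γ_b ∈ {0,-1} for such a, b.  Thus the increments of the coefficient
-- sequence x (with x_0 = x_n = 0, x_m = d) rise by at most one in total on each side of m.
-- Existence: the tent d ∸ ∣ j - m ∣ has increments ±[distance < d], which qualify.
-- Uniqueness: a discrete staircase lemma forces x_j = d ∸ (m ∸ j) on [0,m], and, applied
-- to the reflected sequence, x_j = d ∸ (j ∸ m) on [m,n].
-- Δ_{P'_d}: ⟨γ, α_i⟩ is the change of slope of the tent at distance ∣ i - m ∣ ≠ 0,
-- nonzero exactly at distance d.
-- Longest element: w0P i j reverses [i, j+1] and has an explicit word.  When J omits the
-- cut points t₁ ≤ t₂ ≤ t₃, W_J preserves the block of each position, so inversions lie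
-- within blocks, where the product of block reversals is decreasing: it has them all.

≤ᵇ-true : ∀ {m n} → m ≤ n → (m ≤ᵇ n) ≡ true
≤ᵇ-true {m} {n} = dec-true (m ≤? n)

≤ᵇ-false : ∀ {m n} → ¬ m ≤ n → (m ≤ᵇ n) ≡ false
≤ᵇ-false {m} {n} = dec-false (m ≤? n)

<ᵇ-true : ∀ {m n} → m < n → (m <ᵇ n) ≡ true
<ᵇ-true {m} {n} = dec-true (m <? n)

<ᵇ-false : ∀ {m n} → ¬ m < n → (m <ᵇ n) ≡ false
<ᵇ-false {m} {n} = dec-false (m <? n)

≡ᵇ-refl : ∀ m → (m ≡ᵇ m) ≡ true
≡ᵇ-refl m = dec-true (m ≟ m) refl

≡ᵇ-false : ∀ {m n} → m ≢ n → (m ≡ᵇ n) ≡ false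
≡ᵇ-false {m} {n} = dec-false (m ≟ n)

*-distribˡ-minus : ∀ a b c → a ℤ.* (b ℤ.- c) ≡ a ℤ.* b ℤ.- a ℤ.* c
*-distribˡ-minus = solve-∀

neg-minus : ∀ x y → x ℤ.- y ≡ ℤ.- (y ℤ.- x)
neg-minus = solve-∀

+-minus : ∀ {m n} → n ≤ m → + m ℤ.- + n ≡ + (m ∸ n)
+-minus {m} {n} n≤m = trans (ℤP.m-n≡m⊖n m n) (ℤP.⊖-≥ n≤m)

<-from-≤∸1 : ∀ {i n} → 1 ≤ i → i ≤ n ∸ 1 → i < n
<-from-≤∸1 {n = zero}  (s≤s _) ()
<-from-≤∸1 {n = suc n} _       i≤n = s≤s i≤n

∸-pred : ∀ {m j} → 1 ≤ j → j ≤ m → m ∸ pred j ≡ suc (m ∸ j)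
∸-pred {suc m} {suc j} _ (s≤s j≤m) = ℕP.+-∸-assoc 1 j≤m

∸-pred-right : ∀ {m i} → m < i → i ∸ m ≡ suc (pred i ∸ m)
∸-pred-right {m} {suc i} (s≤s m≤i) = ℕP.+-∸-assoc 1 m≤i

sumℤ-cong : ∀ N f g → (∀ j → 1 ≤ j → j ≤ N → f j ≡ g j) → sumℤ N f ≡ sumℤ N g
sumℤ-cong zero    f g f≗g = refl
sumℤ-cong (suc N) f g f≗g =
  cong₂ ℤ._+_ (sumℤ-cong N f g (λ j 1≤j j≤N → f≗g j 1≤j (ℕP.m≤n⇒m≤1+n j≤N)))
              (f≗g (suc N) (s≤s z≤n) ℕP.≤-refl)

sumℤ-zero : ∀ N f → (∀ j → 1 ≤ j → j ≤ N → f j ≡ 0ℤ) → sumℤ N f ≡ 0ℤ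
sumℤ-zero zero    f f≗0 = refl
sumℤ-zero (suc N) f f≗0 =
  cong₂ ℤ._+_ (sumℤ-zero N f (λ j 1≤j j≤N → f≗0 j 1≤j (ℕP.m≤n⇒m≤1+n j≤N)))
              (f≗0 (suc N) (s≤s z≤n) ℕP.≤-refl)

sumℤ-single : ∀ N f a → 1 ≤ a → a ≤ N → (∀ j → j ≢ a → f j ≡ 0ℤ) → sumℤ N f ≡ f a
sumℤ-single zero    f (suc a) 1≤a () f≗0
sumℤ-single (suc N) f a 1≤a a≤1+N f≗0 with a ≟ suc N
... | yes refl = begin
  sumℤ N f ℤ.+ f a ≡⟨ cong (ℤ._+ f a) (sumℤ-zero N f (λ j _ j≤N → f≗0 j (ℕP.<⇒≢ (s≤s j≤N)))) ⟩
  0ℤ ℤ.+ f a       ≡⟨ ℤP.+-identityˡ (f a) ⟩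
  f a              ∎
  where open ≡-Reasoning
... | no a≢1+N = begin
  sumℤ N f ℤ.+ f (suc N) ≡⟨ cong₂ ℤ._+_ (sumℤ-single N f a 1≤a a≤N f≗0) (f≗0 (suc N) (λ eq → a≢1+N (sym eq))) ⟩
  f a ℤ.+ 0ℤ             ≡⟨ ℤP.+-identityʳ (f a) ⟩
  f a                    ∎
  where
  open ≡-Reasoning
  a≤N : a ≤ N
  a≤N = ℕP.≤-pred (ℕP.≤∧≢⇒< a≤1+N a≢1+N)

sumℤ-sub : ∀ N f g → sumℤ N (λ j → f j ℤ.- g j) ≡ sumℤ N f ℤ.- sumℤ N g
sumℤ-sub zero    f g = refl
sumℤ-sub (suc N) f g =
  trans (cong (ℤ._+ (f (suc N) ℤ.- g (suc N))) (sumℤ-sub N f g))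
        (interchange (sumℤ N f) (sumℤ N g) (f (suc N)) (g (suc N)))
  where
  interchange : ∀ a b c d → (a ℤ.- b) ℤ.+ (c ℤ.- d) ≡ (a ℤ.+ c) ℤ.- (b ℤ.+ d)
  interchange = solve-∀

sumℤ-telescope : ∀ N (F : ℕ → ℤ) → sumℤ N (λ j → F j ℤ.- F (pred j)) ≡ F N ℤ.- F 0
sumℤ-telescope zero    F = sym (ℤP.+-inverseʳ (F 0))
sumℤ-telescope (suc N) F =
  trans (cong (ℤ._+ (F (suc N) ℤ.- F N)) (sumℤ-telescope N F)) (collapse (F N) (F 0) (F (suc N)))
  where
  collapse : ∀ x y z → (x ℤ.- y) ℤ.+ (z ℤ.- x) ≡ z ℤ.- y
  collapse = solve-∀

sumℕ-mono : ∀ N f g → (∀ j → 1 ≤ j → j ≤ N → f j ≤ g j) → sumℕ N f ≤ sumℕ N g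
sumℕ-mono zero    f g f≤g = z≤n
sumℕ-mono (suc N) f g f≤g =
  ℕP.+-mono-≤ (sumℕ-mono N f g (λ j 1≤j j≤N → f≤g j 1≤j (ℕP.m≤n⇒m≤1+n j≤N)))
              (f≤g (suc N) (s≤s z≤n) ℕP.≤-refl)

e-diag : ∀ a → e a a ≡ + 1
e-diag a rewrite ≡ᵇ-refl a = refl

e-off : ∀ a j → a ≢ j → e a j ≡ 0ℤ
e-off a j a≢j rewrite ≡ᵇ-false a≢j = refl

root : ℕ → ℕ → ℕ → ℤ
root a b j = e a j ℤ.- e b j

pairing-basis : ∀ N (u : ℕ → ℤ) a → 1 ≤ a → a ≤ N → sumℤ N (λ j → u j ℤ.* e a j) ≡ u a
pairing-basis N u a 1≤a a≤N =
  trans (sumℤ-single N (λ j → u j ℤ.* e a j) a 1≤a a≤N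
          (λ j j≢a → trans (cong (u j ℤ.*_) (e-off a j (λ a≡j → j≢a (sym a≡j)))) (ℤP.*-zeroʳ (u j))))
        (trans (cong (u a ℤ.*_) (e-diag a)) (ℤP.*-identityʳ (u a)))

pairing-root : ∀ n u α a b → 1 ≤ a → a ≤ n → 1 ≤ b → b ≤ n →
  α ≈[ n ] root a b → pairing n u α ≡ u a ℤ.- u b
pairing-root n u α a b 1≤a a≤n 1≤b b≤n α≈ = begin
  pairing n u α                                                  ≡⟨ sumℤ-cong n _ _ distribute ⟩
  sumℤ n (λ j → u j ℤ.* e a j ℤ.- u j ℤ.* e b j)                ≡⟨ sumℤ-sub n _ _ ⟩
  sumℤ n (λ j → u j ℤ.* e a j) ℤ.- sumℤ n (λ j → u j ℤ.* e b j) ≡⟨ cong₂ ℤ._-_ (pairing-basis n u a 1≤a a≤n) (pairing-basis n u b 1≤b b≤n) ⟩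
  u a ℤ.- u b                                                    ∎
  where
  open ≡-Reasoning
  distribute : ∀ j → 1 ≤ j → j ≤ n → u j ℤ.* α j ≡ u j ℤ.* e a j ℤ.- u j ℤ.* e b j
  distribute j 1≤j j≤n = trans (cong (u j ℤ.*_) (α≈ j 1≤j j≤n)) (*-distribˡ-minus (u j) (e a j) (e b j))

-- Coordinates of a combination of simple (co)roots.  Coefficients c i matter only
-- for i ∈ [1,K]; `trunc K c` extends them by 0, in particular to index 0.

trunc : ℕ → (ℕ → ℤ) → ℕ → ℤ
trunc K c j = if (1 ≤ᵇ j) ∧ (j ≤ᵇ K) then c j else 0ℤ

trunc-in : ∀ K c j → 1 ≤ j → j ≤ K → trunc K c j ≡ c j
trunc-in K c (suc j) 1≤j j≤K rewrite ≤ᵇ-true j≤K = refl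

trunc-out : ∀ K c j → K < j → trunc K c j ≡ 0ℤ
trunc-out K c zero    K<j = refl
trunc-out K c (suc j) K<j rewrite ≤ᵇ-false (ℕP.<⇒≱ K<j) = refl

coefficient-sum : ∀ K c j → sumℤ K (λ i → c i ℤ.* e i j) ≡ trunc K c j
coefficient-sum K c zero = sumℤ-zero K _ (λ { (suc i) _ _ → ℤP.*-zeroʳ (c (suc i)) })
coefficient-sum K c (suc j) with suc j ≤? K
... | yes j≤K = begin
  sumℤ K (λ i → c i ℤ.* e i (suc j)) ≡⟨ sumℤ-single K _ (suc j) (s≤s z≤n) j≤K off-diagonal ⟩
  c (suc j) ℤ.* e (suc j) (suc j)    ≡⟨ trans (cong (c (suc j) ℤ.*_) (e-diag (suc j))) (ℤP.*-identityʳ (c (suc j))) ⟩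
  c (suc j)                          ≡⟨ trunc-in K c (suc j) (s≤s z≤n) j≤K ⟨
  trunc K c (suc j)                  ∎
  where
  open ≡-Reasoning
  off-diagonal : ∀ i → i ≢ suc j → c i ℤ.* e i (suc j) ≡ 0ℤ
  off-diagonal i i≢j = trans (cong (c i ℤ.*_) (e-off i (suc j) i≢j)) (ℤP.*-zeroʳ (c i))
... | no j≰K =
  trans (sumℤ-zero K _ (λ i _ i≤K → trans (cong (c i ℤ.*_) (e-off i (suc j) (λ { refl → j≰K i≤K }))) (ℤP.*-zeroʳ (c i))))
        (sym (trunc-out K c (suc j) (ℕP.≰⇒> j≰K)))

-- The j-th coordinate of Σ_{i=1}^{K} c_i (e_i - e_{i+1}) is c_j - c_{j-1}.
-- Both corootVec and the combinations in NonnegCombΔP have this shape.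
combination-coordinate : ∀ K c j →
  sumℤ K (λ i → c i ℤ.* (e i j ℤ.- e (suc i) j)) ≡ trunc K c j ℤ.- trunc K c (pred j)
combination-coordinate K c j = begin
  sumℤ K (λ i → c i ℤ.* (e i j ℤ.- e (suc i) j))                           ≡⟨ sumℤ-cong K _ _ (λ i _ _ → *-distribˡ-minus (c i) (e i j) (e (suc i) j)) ⟩
  sumℤ K (λ i → c i ℤ.* e i j ℤ.- c i ℤ.* e (suc i) j)                    ≡⟨ sumℤ-sub K _ _ ⟩
  sumℤ K (λ i → c i ℤ.* e i j) ℤ.- sumℤ K (λ i → c i ℤ.* e (suc i) j)     ≡⟨ cong₂ ℤ._-_ (coefficient-sum K c j) (shifted j) ⟩
  trunc K c j ℤ.- trunc K c (pred j)                                       ∎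
  where
  open ≡-Reasoning
  shifted : ∀ j → sumℤ K (λ i → c i ℤ.* e (suc i) j) ≡ trunc K c (pred j)
  shifted zero    = sumℤ-zero K _ (λ i _ _ → ℤP.*-zeroʳ (c i))
  shifted (suc j) = coefficient-sum K c j

partial-sum-combination : ∀ K c m → 1 ≤ m → m ≤ K →
  sumℤ m (λ j → trunc K c j ℤ.- trunc K c (pred j)) ≡ c m
partial-sum-combination K c m 1≤m m≤K =
  trans (sumℤ-telescope m (trunc K c))
        (trans (ℤP.+-identityʳ (trunc K c m)) (trunc-in K c m 1≤m m≤K))

-- The roots of R_P^+ are exactly the e_a - e_b (a < b) not straddling m.

SameSide : ℕ → ℕ → ℕ → Set
SameSide m a b = (b ≤ m) ⊎ (m < a)

-- If e_a - e_b = Σ k_i α_i with k_m = 0, then a ≤ m < b is impossible: the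
-- coordinates of e_a - e_b summed over [1,m] give 1, but by telescoping they give k_m.
RPplus-sameSide : ∀ n m α a b → 1 ≤ m → m ≤ n ∸ 1 → NonnegCombΔP n m α →
  1 ≤ a → b ≤ n → α ≈[ n ] root a b → SameSide m a b
RPplus-sameSide n m α a b 1≤m m≤k (κ , κm≡0 , α≈comb) 1≤a b≤n α≈root with b ≤? m | m <? a
... | yes b≤m | _       = inj₁ b≤m
... | no  _   | yes m<a = inj₂ m<a
... | no  b≰m | no  m≮a = ⊥-elim (+1≢+0 (trans (sym sum-as-root) sum-as-combination))
  where
  m≤n : m ≤ n
  m≤n = ℕP.≤-trans m≤k (ℕP.m∸n≤m n 1)
  +1≢+0 : + 1 ≢ + 0
  +1≢+0 ()
  sum-as-root : sumℤ m α ≡ + 1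
  sum-as-root = begin
    sumℤ m α                           ≡⟨ sumℤ-cong m _ _ (λ j 1≤j j≤m → α≈root j 1≤j (ℕP.≤-trans j≤m m≤n)) ⟩
    sumℤ m (root a b)                  ≡⟨ sumℤ-sub m (e a) (e b) ⟩
    sumℤ m (e a) ℤ.- sumℤ m (e b)      ≡⟨ cong₂ ℤ._-_ a-counted b-missed ⟩
    + 1                                ∎
    where
    open ≡-Reasoning
    a-counted : sumℤ m (e a) ≡ + 1
    a-counted = trans (sumℤ-cong m _ _ (λ j _ _ → sym (ℤP.*-identityˡ (e a j))))
                      (pairing-basis m (λ _ → + 1) a 1≤a (ℕP.≮⇒≥ m≮a))
    b-missed : sumℤ m (e b) ≡ 0ℤ
    b-missed = sumℤ-zero m (e b) (λ j _ j≤m → e-off b j (λ { refl → b≰m j≤m }))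
  sum-as-combination : sumℤ m α ≡ + 0
  sum-as-combination = begin
    sumℤ m α                                               ≡⟨ sumℤ-cong m _ _ as-combination ⟩
    sumℤ m (λ j → trunc (n ∸ 1) κ′ j ℤ.- trunc (n ∸ 1) κ′ (pred j)) ≡⟨ partial-sum-combination (n ∸ 1) κ′ m 1≤m m≤k ⟩
    + κ m                                                  ≡⟨ cong +_ κm≡0 ⟩
    + 0                                                    ∎
    where
    open ≡-Reasoning
    κ′ : ℕ → ℤ
    κ′ i = + κ i
    as-combination : ∀ j → 1 ≤ j → j ≤ m → α j ≡ trunc (n ∸ 1) κ′ j ℤ.- trunc (n ∸ 1) κ′ (pred j)
    as-combination j 1≤j j≤m = trans (α≈comb j 1≤j (ℕP.≤-trans j≤m m≤n)) (combination-coordinate (n ∸ 1) κ′ j)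

-- Indicator of [a,b): the coefficients in e_a - e_b = Σ_{a ≤ i < b} α_i.
interval : ℕ → ℕ → ℕ → ℕ
interval a b i = if (a ≤ᵇ i) ∧ (i <ᵇ b) then 1 else 0

interval-inside : ∀ a b {i} → a ≤ i → i < b → interval a b i ≡ 1
interval-inside a b a≤i i<b rewrite ≤ᵇ-true a≤i | <ᵇ-true i<b = refl

interval-below : ∀ a b {i} → i < a → interval a b i ≡ 0
interval-below a b i<a rewrite ≤ᵇ-false (ℕP.<⇒≱ i<a) = refl

interval-above : ∀ a b {i} → b ≤ i → interval a b i ≡ 0
interval-above a b {i} b≤i rewrite <ᵇ-false (ℕP.≤⇒≯ b≤i) with a ≤ᵇ i
... | true  = refl
... | false = refl

root-as-interval : ∀ a b j → a < b → 1 ≤ j →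
  root a b j ≡ + interval a b j ℤ.- + interval a b (pred j)
root-as-interval a b (suc j) a<b _ with ℕP.<-cmp (suc j) a
... | tri< j<a _ _
  rewrite e-off a (suc j) (ℕP.>⇒≢ j<a) | e-off b (suc j) (ℕP.>⇒≢ (ℕP.<-trans j<a a<b))
        | interval-below a b j<a | interval-below a b (ℕP.<-trans (ℕP.n<1+n j) j<a) = refl
... | tri≈ _ refl _
  rewrite e-diag (suc j) | e-off b (suc j) (ℕP.>⇒≢ a<b)
        | interval-inside (suc j) b ℕP.≤-refl a<b | interval-below (suc j) b (ℕP.n<1+n j) = refl
... | tri> _ _ a<j with ℕP.<-cmp (suc j) b
...   | tri< j<b _ _
  rewrite e-off a (suc j) (ℕP.<⇒≢ a<j) | e-off b (suc j) (ℕP.>⇒≢ j<b)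
        | interval-inside a b (ℕP.<⇒≤ a<j) j<b | interval-inside a b (ℕP.≤-pred a<j) (ℕP.<-trans (ℕP.n<1+n j) j<b) = refl
...   | tri≈ _ refl _
  rewrite e-off a (suc j) (ℕP.<⇒≢ a<j) | e-diag (suc j)
        | interval-above a (suc j) ℕP.≤-refl | interval-inside a (suc j) (ℕP.≤-pred a<j) (ℕP.n<1+n j) = refl
...   | tri> _ _ b<j
  rewrite e-off a (suc j) (ℕP.<⇒≢ a<j) | e-off b (suc j) (ℕP.<⇒≢ b<j)
        | interval-above a b (ℕP.<⇒≤ b<j) | interval-above a b (ℕP.≤-pred b<j) = refl

sameSide-root∈RPplus : ∀ n m a b → 1 ≤ a → a < b → b ≤ n → SameSide m a b →
  InRPplus n m (root a b)
sameSide-root∈RPplus n m a b 1≤a a<b b≤n side =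
  a , b , 1≤a , a<b , b≤n , (λ _ _ _ → refl) , interval a b , interval-at-m side , coordinates
  where
  interval-at-m : SameSide m a b → interval a b m ≡ 0
  interval-at-m (inj₁ b≤m) = interval-above a b b≤m
  interval-at-m (inj₂ m<a) = interval-below a b m<a
  κ : ℕ → ℤ
  κ i = + interval a b i
  trunc-interval : ∀ j → j ≤ n → trunc (n ∸ 1) κ j ≡ κ j
  trunc-interval zero    _ = cong +_ (sym (interval-below a b 1≤a))
  trunc-interval (suc j) j<n with suc j ≤? n ∸ 1
  ... | yes j≤k = trunc-in (n ∸ 1) κ (suc j) (s≤s z≤n) j≤k
  ... | no  j≰k = trans (trunc-out (n ∸ 1) κ (suc j) (ℕP.≰⇒> j≰k))
                        (cong +_ (sym (interval-above a b (ℕP.≤-trans b≤n (ℕP.≤-trans (ℕP.m≤n+m∸n n 1) (ℕP.≰⇒> j≰k))))))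
  coordinates : root a b ≈[ n ] (λ j → sumℤ (n ∸ 1) (λ i → κ i ℤ.* simpleRoot i j))
  coordinates j 1≤j j≤n = begin
    root a b j                                     ≡⟨ root-as-interval a b j a<b 1≤j ⟩
    κ j ℤ.- κ (pred j)                             ≡⟨ cong₂ ℤ._-_ (trunc-interval j j≤n) (trunc-interval (pred j) (ℕP.≤-trans ℕP.pred[n]≤n j≤n)) ⟨
    trunc (n ∸ 1) κ j ℤ.- trunc (n ∸ 1) κ (pred j) ≡⟨ combination-coordinate (n ∸ 1) κ j ⟨
    sumℤ (n ∸ 1) (λ i → κ i ℤ.* simpleRoot i j)   ∎
    where open ≡-Reasoning

ZeroOrNegOne : ℤ → Set
ZeroOrNegOne z = (z ≡ 0ℤ) ⊎ (z ≡ -[1+ 0 ])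

RootCondition : ℕ → ℕ → (ℕ → ℤ) → Set
RootCondition n m γ = ∀ α → InRPplus n m α → ZeroOrNegOne (pairing n γ α)

CoordinateCondition : ℕ → ℕ → (ℕ → ℤ) → Set
CoordinateCondition n m γ =
  ∀ a b → 1 ≤ a → a < b → b ≤ n → SameSide m a b → ZeroOrNegOne (γ a ℤ.- γ b)

coordinate⇒root-condition : ∀ n m γ → 1 ≤ m → m ≤ n ∸ 1 →
  CoordinateCondition n m γ → RootCondition n m γ
coordinate⇒root-condition n m γ 1≤m m≤k coord α (a , b , 1≤a , a<b , b≤n , α≈root , comb) =
  subst ZeroOrNegOne (sym (pairing-root n γ α a b 1≤a a≤n 1≤b b≤n α≈root))
        (coord a b 1≤a a<b b≤n (RPplus-sameSide n m α a b 1≤m m≤k comb 1≤a b≤n α≈root))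
  where
  a≤n = ℕP.≤-trans (ℕP.<⇒≤ a<b) b≤n
  1≤b = ℕP.≤-trans 1≤a (ℕP.<⇒≤ a<b)

root⇒coordinate-condition : ∀ n m γ → RootCondition n m γ → CoordinateCondition n m γ
root⇒coordinate-condition n m γ roots a b 1≤a a<b b≤n side =
  subst ZeroOrNegOne (pairing-root n γ (root a b) a b 1≤a (ℕP.≤-trans (ℕP.<⇒≤ a<b) b≤n) (ℕP.≤-trans 1≤a (ℕP.<⇒≤ a<b)) b≤n (λ _ _ _ → refl))
        (roots (root a b) (sameSide-root∈RPplus n m a b 1≤a a<b b≤n side))

distance≡ : ∀ {i m d} → d ≤ m → ∣ i - m ∣ ≡ d → (i ≡ m ∸ d) ⊎ (i ≡ m + d)
distance≡ {i} {m} {d} d≤m dist≡d with ℕP.≤-total i m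
... | inj₁ i≤m = inj₁ (begin
  i             ≡⟨ ℕP.m∸[m∸n]≡n i≤m ⟨
  m ∸ (m ∸ i)   ≡⟨ cong (m ∸_) (trans (sym (ℕP.m≤n⇒∣m-n∣≡n∸m i≤m)) dist≡d) ⟩
  m ∸ d         ∎)
  where open ≡-Reasoning
... | inj₂ m≤i = inj₂ (begin
  i             ≡⟨ ℕP.m+[n∸m]≡n m≤i ⟨
  m + (i ∸ m)   ≡⟨ cong (λ x → m + x) (trans (sym (ℕP.m≤n⇒∣n-m∣≡n∸m m≤i)) dist≡d) ⟩
  m + d         ∎)
  where open ≡-Reasoning

distance-m∸d : ∀ {m d} → d ≤ m → ∣ m ∸ d - m ∣ ≡ d
distance-m∸d {m} {d} d≤m = trans (ℕP.m≤n⇒∣m-n∣≡n∸m (ℕP.m∸n≤m m d)) (ℕP.m∸[m∸n]≡n d≤m)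

distance-m+d : ∀ m d → ∣ m + d - m ∣ ≡ d
distance-m+d m d = trans (ℕP.m≤n⇒∣n-m∣≡n∸m (ℕP.m≤m+n m d)) (ℕP.m+n∸m≡n m d)

-- The tent function j ↦ d ∸ ∣ j - m ∣ (the explicit d_B) has slopes in {0, ±1};
-- `slope d u` = (d ∸ u) - (d ∸ (u+1)) = [u < d] is its descent at distance u from m.

slope : ℕ → ℕ → ℤ
slope d u = + (d ∸ u) ℤ.- + (d ∸ suc u)

slope-below : ∀ {d u} → u < d → slope d u ≡ + 1
slope-below {d} {u} u<d = begin
  + (d ∸ u) ℤ.- + (d ∸ suc u)        ≡⟨ cong (λ x → + x ℤ.- + (d ∸ suc u)) (∸-pred {d} {suc u} (s≤s z≤n) u<d) ⟩
  + suc (d ∸ suc u) ℤ.- + (d ∸ suc u) ≡⟨ +-minus (ℕP.n≤1+n (d ∸ suc u)) ⟩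
  + (suc (d ∸ suc u) ∸ (d ∸ suc u))   ≡⟨ cong +_ (ℕP.m+n∸n≡m 1 (d ∸ suc u)) ⟩
  + 1                                 ∎
  where open ≡-Reasoning

slope-above : ∀ {d u} → d ≤ u → slope d u ≡ 0ℤ
slope-above {d} {u} d≤u rewrite ℕP.m≤n⇒m∸n≡0 d≤u | ℕP.m≤n⇒m∸n≡0 (ℕP.m≤n⇒m≤1+n d≤u) = refl

slope-antitone : ∀ d {u v} → u ≤ v → ZeroOrNegOne (slope d v ℤ.- slope d u)
slope-antitone d {u} {v} u≤v with u <? d | v <? d
... | yes u<d | yes v<d rewrite slope-below v<d | slope-below u<d = inj₁ refl
... | yes u<d | no  v≮d rewrite slope-above (ℕP.≮⇒≥ v≮d) | slope-below u<d = inj₂ refl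
... | no  u≮d | yes v<d = ⊥-elim (u≮d (ℕP.≤-<-trans u≤v v<d))
... | no  u≮d | no  v≮d rewrite slope-above (ℕP.≮⇒≥ v≮d) | slope-above (ℕP.≮⇒≥ u≮d) = inj₁ refl

slope-jump : ∀ d v → (slope d (suc v) ℤ.- slope d v ≡ 0ℤ) ⇔ (suc v ≢ d)
slope-jump d v = mk⇔ to from
  where
  to : slope d (suc v) ℤ.- slope d v ≡ 0ℤ → suc v ≢ d
  to jump≡0 refl rewrite slope-above {d} {d} ℕP.≤-refl | slope-below {d} {v} ℕP.≤-refl with jump≡0
  ... | ()
  from : suc v ≢ d → slope d (suc v) ℤ.- slope d v ≡ 0ℤ
  from 1+v≢d with v <? d
  ... | no  v≮d rewrite slope-above (ℕP.≮⇒≥ v≮d) | slope-above (ℕP.m≤n⇒m≤1+n (ℕP.≮⇒≥ v≮d)) = refl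
  ... | yes v<d rewrite slope-below v<d | slope-below (ℕP.≤∧≢⇒< v<d 1+v≢d) = refl

module Tent (n m d : ℕ) (1≤m : 1 ≤ m) (m≤k : m ≤ n ∸ 1) (d≤m : d ≤ m) (d≤r : d ≤ n ∸ m) where

  c : ℕ → ℤ
  c = dBexplicit m d

  γ : ℕ → ℤ
  γ = corootVec n c

  m<n : m < n
  m<n = <-from-≤∸1 1≤m m≤k

  -- The tent vanishes at 0 and at n, so truncating to [1, n-1] does not change it.
  trunc-tent : ∀ j → j ≤ n → trunc (n ∸ 1) c j ≡ c j
  trunc-tent zero    _ = cong +_ (sym (ℕP.m≤n⇒m∸n≡0 d≤m))
  trunc-tent (suc j) j<n with suc j ≤? n ∸ 1
  ... | yes j≤k = trunc-in (n ∸ 1) c (suc j) (s≤s z≤n) j≤k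
  ... | no  j≰k = trans (trunc-out (n ∸ 1) c (suc j) (ℕP.≰⇒> j≰k))
                        (sym (tent-vanishes-right (suc j) (ℕP.≤-trans (ℕP.m≤n+m∸n n 1) (ℕP.≰⇒> j≰k))))
    where
    tent-vanishes-right : ∀ j → n ≤ j → c j ≡ 0ℤ
    tent-vanishes-right j n≤j = cong +_ (ℕP.m≤n⇒m∸n≡0 (begin
      d           ≤⟨ d≤r ⟩
      n ∸ m       ≤⟨ ℕP.∸-monoˡ-≤ m n≤j ⟩
      j ∸ m       ≡⟨ ℕP.m≤n⇒∣n-m∣≡n∸m (ℕP.≤-trans (ℕP.<⇒≤ m<n) n≤j) ⟨
      ∣ j - m ∣   ∎))
      where open ℕP.≤-Reasoning

  γ-coordinate : ∀ j → j ≤ n → γ j ≡ c j ℤ.- c (pred j)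
  γ-coordinate j j≤n =
    trans (combination-coordinate (n ∸ 1) c j)
          (cong₂ ℤ._-_ (trunc-tent j j≤n) (trunc-tent (pred j) (ℕP.≤-trans ℕP.pred[n]≤n j≤n)))

  γ-left : ∀ j → 1 ≤ j → j ≤ m → γ j ≡ slope d (m ∸ j)
  γ-left j 1≤j j≤m = begin
    γ j                                       ≡⟨ γ-coordinate j (ℕP.≤-trans j≤m (ℕP.<⇒≤ m<n)) ⟩
    c j ℤ.- c (pred j)                        ≡⟨ cong₂ (λ x y → + (d ∸ x) ℤ.- + (d ∸ y))
                                                        (ℕP.m≤n⇒∣m-n∣≡n∸m j≤m) (ℕP.m≤n⇒∣m-n∣≡n∸m (ℕP.≤-trans ℕP.pred[n]≤n j≤m)) ⟩
    + (d ∸ (m ∸ j)) ℤ.- + (d ∸ (m ∸ pred j))  ≡⟨ cong (λ x → + (d ∸ (m ∸ j)) ℤ.- + (d ∸ x)) (∸-pred 1≤j j≤m) ⟩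
    slope d (m ∸ j)                           ∎
    where open ≡-Reasoning

  γ-right : ∀ j → m < j → j ≤ n → γ j ≡ ℤ.- slope d (pred j ∸ m)
  γ-right (suc j) (s≤s m≤j) j<n = begin
    γ (suc j)                                 ≡⟨ γ-coordinate (suc j) j<n ⟩
    c (suc j) ℤ.- c j                         ≡⟨ cong₂ (λ x y → + (d ∸ x) ℤ.- + (d ∸ y))
                                                        (ℕP.m≤n⇒∣n-m∣≡n∸m (ℕP.m≤n⇒m≤1+n m≤j)) (ℕP.m≤n⇒∣n-m∣≡n∸m m≤j) ⟩
    + (d ∸ (suc j ∸ m)) ℤ.- + (d ∸ (j ∸ m))   ≡⟨ cong (λ x → + (d ∸ x) ℤ.- + (d ∸ (j ∸ m))) (ℕP.+-∸-assoc 1 m≤j) ⟩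
    + (d ∸ suc (j ∸ m)) ℤ.- + (d ∸ (j ∸ m))   ≡⟨ neg-minus (+ (d ∸ suc (j ∸ m))) (+ (d ∸ (j ∸ m))) ⟩
    ℤ.- slope d (j ∸ m)                       ∎
    where open ≡-Reasoning

  coordinate-condition : CoordinateCondition n m γ
  coordinate-condition a b 1≤a a<b b≤n (inj₁ b≤m)
    rewrite γ-left a 1≤a (ℕP.≤-trans (ℕP.<⇒≤ a<b) b≤m) | γ-left b (ℕP.≤-trans 1≤a (ℕP.<⇒≤ a<b)) b≤m =
    slope-antitone d (ℕP.∸-monoʳ-≤ m (ℕP.<⇒≤ a<b))
  coordinate-condition a b 1≤a a<b b≤n (inj₂ m<a)
    rewrite γ-right a m<a (ℕP.≤-trans (ℕP.<⇒≤ a<b) b≤n) | γ-right b (ℕP.<-trans m<a a<b) b≤n =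
    subst ZeroOrNegOne (swap-negations (slope d (pred b ∸ m)) (slope d (pred a ∸ m)))
          (slope-antitone d (ℕP.∸-monoˡ-≤ m (ℕP.pred-mono-≤ (ℕP.<⇒≤ a<b))))
    where
    swap-negations : ∀ x y → x ℤ.- y ≡ ℤ.- y ℤ.- ℤ.- x
    swap-negations = solve-∀

  isGammaDB : IsGammaDB n m d c
  isGammaDB = congruence , coordinate⇒root-condition n m γ 1≤m m≤k coordinate-condition
    where
    shift : ℕ → ℤ
    shift i = if i ≡ᵇ m then + d else 0ℤ
    split : ∀ x y → x ≡ y ℤ.+ (x ℤ.- y)
    split = solve-∀
    shift-at-m : c m ℤ.- shift m ≡ 0ℤ
    shift-at-m rewrite ≡ᵇ-refl m | ℕP.∣n-n∣≡0 m = ℤP.+-inverseʳ (+ d)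
    congruence : CongModQP n m d c
    congruence = (λ i → c i ℤ.- shift i) , shift-at-m , (λ i _ _ → split (c i) (shift i))

  pairing-simpleRoot-coordinates : ∀ i → 1 ≤ i → i ≤ n ∸ 1 → pairing n γ (simpleRoot i) ≡ γ i ℤ.- γ (suc i)
  pairing-simpleRoot-coordinates i 1≤i i≤k =
    pairing-root n γ (simpleRoot i) i (suc i) 1≤i (ℕP.<⇒≤ i<n) (s≤s z≤n) i<n (λ _ _ _ → refl)
    where
    i<n = <-from-≤∸1 1≤i i≤k

  pairing-simpleRoot : ∀ i → 1 ≤ i → i ≤ n ∸ 1 → i ≢ m →
    Σ ℕ λ v → (∣ i - m ∣ ≡ suc v) × (pairing n γ (simpleRoot i) ≡ slope d (suc v) ℤ.- slope d v)
  pairing-simpleRoot i 1≤i i≤k i≢m with ℕP.<-cmp i m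
  ... | tri≈ _ i≡m _ = ⊥-elim (i≢m i≡m)
  ... | tri< i<m _ _ = m ∸ suc i , distance , (begin
    pairing n γ (simpleRoot i)           ≡⟨ pairing-simpleRoot-coordinates i 1≤i i≤k ⟩
    γ i ℤ.- γ (suc i)                    ≡⟨ cong₂ ℤ._-_ (γ-left i 1≤i (ℕP.<⇒≤ i<m)) (γ-left (suc i) (s≤s z≤n) i<m) ⟩
    slope d (m ∸ i) ℤ.- slope d (m ∸ suc i) ≡⟨ cong (λ x → slope d x ℤ.- slope d (m ∸ suc i)) (∸-pred (s≤s z≤n) i<m) ⟩
    slope d (suc (m ∸ suc i)) ℤ.- slope d (m ∸ suc i) ∎)
    where
    open ≡-Reasoning
    distance : ∣ i - m ∣ ≡ suc (m ∸ suc i)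
    distance = trans (ℕP.m≤n⇒∣m-n∣≡n∸m (ℕP.<⇒≤ i<m)) (∸-pred (s≤s z≤n) i<m)
  ... | tri> _ _ m<i = pred i ∸ m , distance , (begin
    pairing n γ (simpleRoot i)           ≡⟨ pairing-simpleRoot-coordinates i 1≤i i≤k ⟩
    γ i ℤ.- γ (suc i)                    ≡⟨ cong₂ ℤ._-_ (γ-right i m<i (ℕP.<⇒≤ i<n)) (γ-right (suc i) (ℕP.m<n⇒m<1+n m<i) i<n) ⟩
    ℤ.- slope d (pred i ∸ m) ℤ.- ℤ.- slope d (i ∸ m) ≡⟨ cong (λ x → ℤ.- slope d (pred i ∸ m) ℤ.- ℤ.- slope d x) (∸-pred-right m<i) ⟩
    ℤ.- slope d (pred i ∸ m) ℤ.- ℤ.- slope d (suc (pred i ∸ m)) ≡⟨ swap-negations (slope d (pred i ∸ m)) (slope d (suc (pred i ∸ m))) ⟩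
    slope d (suc (pred i ∸ m)) ℤ.- slope d (pred i ∸ m) ∎)
    where
    open ≡-Reasoning
    i<n = <-from-≤∸1 1≤i i≤k
    swap-negations : ∀ x y → ℤ.- x ℤ.- ℤ.- y ≡ y ℤ.- x
    swap-negations = solve-∀
    distance : ∣ i - m ∣ ≡ suc (pred i ∸ m)
    distance = trans (ℕP.m≤n⇒∣n-m∣≡n∸m (ℕP.<⇒≤ m<i)) (∸-pred-right m<i)

  ΔP′-characterisation : ∀ i → 1 ≤ i → i ≤ n ∸ 1 →
    InΔP' n m c i ⇔ ((i ≢ m ∸ d) × (i ≢ m) × (i ≢ m + d))
  ΔP′-characterisation i 1≤i i≤k = mk⇔ to from
    where
    to : InΔP' n m c i → (i ≢ m ∸ d) × (i ≢ m) × (i ≢ m + d)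
    to (_ , _ , i≢m , orthogonal) with pairing-simpleRoot i 1≤i i≤k i≢m
    ... | v , dist≡ , pairing≡ =
      (λ { refl → 1+v≢d (trans (sym dist≡) (distance-m∸d d≤m)) }) , i≢m ,
      (λ { refl → 1+v≢d (trans (sym dist≡) (distance-m+d m d)) })
      where
      1+v≢d = Equivalence.to (slope-jump d v) (trans (sym pairing≡) orthogonal)
    from : (i ≢ m ∸ d) × (i ≢ m) × (i ≢ m + d) → InΔP' n m c i
    from (i≢m∸d , i≢m , i≢m+d) with pairing-simpleRoot i 1≤i i≤k i≢m
    ... | v , dist≡ , pairing≡ =
      1≤i , i≤k , i≢m , trans pairing≡ (Equivalence.from (slope-jump d v) 1+v≢d)
      where
      1+v≢d : suc v ≢ d
      1+v≢d 1+v≡d with distance≡ d≤m (trans dist≡ 1+v≡d)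
      ... | inj₁ i≡m∸d = i≢m∸d i≡m∸d
      ... | inj₂ i≡m+d = i≢m+d i≡m+d

increment : (ℕ → ℤ) → ℕ → ℤ
increment x j = x j ℤ.- x (pred j)

increment-step : ∀ x j → x j ≡ x (pred j) ℤ.+ increment x j
increment-step x j = split (x j) (x (pred j))
  where
  split : ∀ y z → y ≡ z ℤ.+ (y ℤ.- z)
  split = solve-∀

growth-≤ : ∀ x a k c → (∀ i → a < i → i ≤ a + k → increment x i ℤ.≤ c) →
  x (a + k) ℤ.≤ x a ℤ.+ + k ℤ.* c
growth-≤ x a zero    c bound rewrite ℕP.+-identityʳ a | ℤP.*-zeroˡ c = ℤP.≤-reflexive (sym (ℤP.+-identityʳ (x a)))
growth-≤ x a (suc k) c bound rewrite ℕP.+-suc a k | increment-step x (suc (a + k)) = begin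
  x (a + k) ℤ.+ increment x (suc (a + k)) ≤⟨ ℤP.+-mono-≤ (growth-≤ x a k c (λ i a<i i≤a+k → bound i a<i (ℕP.m≤n⇒m≤1+n i≤a+k)))
                                                        (bound (suc (a + k)) (s≤s (ℕP.m≤m+n a k)) ℕP.≤-refl) ⟩
  (x a ℤ.+ + k ℤ.* c) ℤ.+ c               ≡⟨ regroup (x a) (+ k) c ⟩
  x a ℤ.+ (+ 1 ℤ.+ + k) ℤ.* c             ∎
  where
  open ℤP.≤-Reasoning
  regroup : ∀ y K C → (y ℤ.+ K ℤ.* C) ℤ.+ C ≡ y ℤ.+ (+ 1 ℤ.+ K) ℤ.* C
  regroup = solve-∀

growth-≥ : ∀ x a k c → (∀ i → a < i → i ≤ a + k → c ℤ.≤ increment x i) →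
  x a ℤ.+ + k ℤ.* c ℤ.≤ x (a + k)
growth-≥ x a zero    c bound rewrite ℕP.+-identityʳ a | ℤP.*-zeroˡ c = ℤP.≤-reflexive (ℤP.+-identityʳ (x a))
growth-≥ x a (suc k) c bound rewrite ℕP.+-suc a k | increment-step x (suc (a + k)) = begin
  x a ℤ.+ (+ 1 ℤ.+ + k) ℤ.* c             ≡⟨ regroup (x a) (+ k) c ⟨
  (x a ℤ.+ + k ℤ.* c) ℤ.+ c               ≤⟨ ℤP.+-mono-≤ (growth-≥ x a k c (λ i a<i i≤a+k → bound i a<i (ℕP.m≤n⇒m≤1+n i≤a+k)))
                                                        (bound (suc (a + k)) (s≤s (ℕP.m≤m+n a k)) ℕP.≤-refl) ⟩
  x (a + k) ℤ.+ increment x (suc (a + k)) ∎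
  where
  open ℤP.≤-Reasoning
  regroup : ∀ y K C → (y ℤ.+ K ℤ.* C) ℤ.+ C ≡ y ℤ.+ (+ 1 ℤ.+ K) ℤ.* C
  regroup = solve-∀

recover : ∀ p q → q ≡ p ℤ.- (p ℤ.- q)
recover = solve-∀

step-values : ∀ p q → ZeroOrNegOne (p ℤ.- q) → (q ≡ p) ⊎ (q ≡ p ℤ.+ + 1)
step-values p q (inj₁ p-q≡0)  = inj₁ (trans (recover p q) (trans (cong (λ z → p ℤ.- z) p-q≡0) (ℤP.+-identityʳ p)))
step-values p q (inj₂ p-q≡-1) = inj₂ (trans (recover p q) (cong (λ z → p ℤ.- z) p-q≡-1))

step-bounds : ∀ p q → ZeroOrNegOne (p ℤ.- q) → (p ℤ.≤ q) × (q ℤ.≤ p ℤ.+ + 1)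
step-bounds p q p-q with step-values p q p-q
... | inj₁ refl = ℤP.≤-refl , ℤP.i≤i+j p (+ 1)
... | inj₂ refl = ℤP.i≤i+j p (+ 1) , ℤP.≤-refl

cancel-+1 : ∀ {i j} → i ℤ.+ + 1 ℤ.≤ j ℤ.+ + 1 → i ℤ.≤ j
cancel-+1 {i} {j} i+1≤j+1 = subst₂ ℤ._≤_ (undo i) (undo j) (ℤP.+-monoˡ-≤ -[1+ 0 ] i+1≤j+1)
  where
  undo : ∀ y → y ℤ.+ + 1 ℤ.+ -[1+ 0 ] ≡ y
  undo = solve-∀

zero-or-one : ∀ z → 0ℤ ℤ.≤ z → z ℤ.≤ + 1 → (z ≡ 0ℤ) ⊎ (z ≡ + 1)
zero-or-one (+ zero)          _ _                = inj₁ refl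
zero-or-one (+ suc zero)      _ _                = inj₂ refl
zero-or-one (+ suc (suc _))   _ (+≤+ (s≤s ()))

no-growth : ∀ y k → y ℤ.+ + k ℤ.* 0ℤ ≡ y
no-growth y k = trans (cong (λ z → y ℤ.+ z) (ℤP.*-zeroʳ (+ k))) (ℤP.+-identityʳ y)

unit-growth : ∀ y k → y ℤ.+ + k ℤ.* + 1 ≡ y ℤ.+ + k
unit-growth y k = cong (λ z → y ℤ.+ z) (ℤP.*-identityʳ (+ k))

suc-pred-≥1 : ∀ {M} → 1 ≤ M → suc (pred M) ≡ M
suc-pred-≥1 (s≤s _) = refl

-- A sequence with x 0 = 0 and x M = d ≤ M whose
-- increments on [1,M] rise, by at most 1 in total, must be the staircase
-- x j = d ∸ (M ∸ j): the increments are forced into {0,1}, all 0 before the last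
-- d steps and all 1 on them.
module Staircase (x : ℕ → ℤ) (M d : ℕ) (d≤M : d ≤ M) (x0 : x 0 ≡ 0ℤ) (xM : x M ≡ + d)
  (steps : ∀ a b → 1 ≤ a → a < b → b ≤ M → ZeroOrNegOne (increment x a ℤ.- increment x b)) where

  δ : ℕ → ℤ
  δ = increment x

  increments-rise : ∀ a b → 1 ≤ a → a ≤ b → b ≤ M → δ a ℤ.≤ δ b
  increments-rise a b 1≤a a≤b b≤M with ℕP.m≤n⇒m<n∨m≡n a≤b
  ... | inj₁ a<b  = proj₁ (step-bounds (δ a) (δ b) (steps a b 1≤a a<b b≤M))
  ... | inj₂ refl = ℤP.≤-refl

  increments-spread : ∀ a b → 1 ≤ a → a ≤ b → b ≤ M → δ b ℤ.≤ δ a ℤ.+ + 1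
  increments-spread a b 1≤a a≤b b≤M with ℕP.m≤n⇒m<n∨m≡n a≤b
  ... | inj₁ a<b  = proj₂ (step-bounds (δ a) (δ b) (steps a b 1≤a a<b b≤M))
  ... | inj₂ refl = ℤP.i≤i+j (δ a) (+ 1)

  -- If δ 1 < 0, all increments are ≤ 0 and x M ≤ x 1 = δ 1 < 0 ≤ d.
  first-increment-nonneg : 1 ≤ M → 0ℤ ℤ.≤ δ 1
  first-increment-nonneg 1≤M with 0ℤ ℤ.≤? δ 1
  ... | yes 0≤δ₁ = 0≤δ₁
  ... | no  0≰δ₁ = ⊥-elim (ℤP.<⇒≱ d<0 (+≤+ z≤n))
    where
    δ₁<0 = ℤP.≰⇒> 0≰δ₁
    later-nonpos : ∀ i → 1 < i → i ≤ 1 + pred M → δ i ℤ.≤ 0ℤ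
    later-nonpos i 1<i i≤M = ℤP.≤-trans (increments-spread 1 i ℕP.≤-refl (ℕP.<⇒≤ 1<i) (subst (i ≤_) (suc-pred-≥1 1≤M) i≤M))
                                        (subst (ℤ._≤ 0ℤ) (ℤP.+-comm (+ 1) (δ 1)) (ℤP.i<j⇒suc[i]≤j δ₁<0))
    d<0 : + d ℤ.< 0ℤ
    d<0 = begin-strict
      + d                          ≡⟨ trans (sym xM) (cong x (sym (suc-pred-≥1 1≤M))) ⟩
      x (1 + pred M)               ≤⟨ growth-≤ x 1 (pred M) 0ℤ later-nonpos ⟩
      x 1 ℤ.+ + pred M ℤ.* 0ℤ      ≡⟨ no-growth (x 1) (pred M) ⟩
      x 1                          ≡⟨ increment-step x 1 ⟩
      x 0 ℤ.+ δ 1                  ≡⟨ trans (cong (ℤ._+ δ 1) x0) (ℤP.+-identityˡ (δ 1)) ⟩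
      δ 1                          <⟨ δ₁<0 ⟩
      0ℤ                           ∎
      where open ℤP.≤-Reasoning

  -- If δ M ≥ 2, all increments are ≥ 1 and x M ≥ (M - 1) + 2 > d.
  last-increment-≤1 : 1 ≤ M → δ M ℤ.≤ + 1
  last-increment-≤1 1≤M with δ M ℤ.≤? + 1
  ... | yes δM≤1 = δM≤1
  ... | no  δM≰1 = ⊥-elim (ℕP.<⇒≱ (ℕP.≤-<-trans d≤M (ℕP.n<1+n M)) (ℤP.drop‿+≤+ M+1≤d))
    where
    2≤δM : + 2 ℤ.≤ δ M
    2≤δM = ℤP.i<j⇒suc[i]≤j (ℤP.≰⇒> δM≰1)
    earlier-positive : ∀ i → 0 < i → i ≤ pred M → + 1 ℤ.≤ δ i
    earlier-positive i 0<i i≤M′ = cancel-+1 (ℤP.≤-trans 2≤δM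
      (increments-spread i M 0<i (ℕP.≤-trans i≤M′ ℕP.pred[n]≤n) ℕP.≤-refl))
    M+1≤d : + suc M ℤ.≤ + d
    M+1≤d = begin
      + suc M                                   ≡⟨ cong +_ (trans (sym (cong suc (suc-pred-≥1 1≤M))) (ℕP.+-comm 2 (pred M))) ⟩
      + pred M ℤ.+ + 2                          ≡⟨ cong (ℤ._+ + 2) (trans (sym (ℤP.+-identityˡ (+ pred M))) (sym (unit-growth 0ℤ (pred M)))) ⟩
      (0ℤ ℤ.+ + pred M ℤ.* + 1) ℤ.+ + 2         ≡⟨ cong (λ z → (z ℤ.+ + pred M ℤ.* + 1) ℤ.+ + 2) (sym x0) ⟩
      (x 0 ℤ.+ + pred M ℤ.* + 1) ℤ.+ + 2        ≤⟨ ℤP.+-mono-≤ (growth-≥ x 0 (pred M) (+ 1) earlier-positive) 2≤δM ⟩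
      x (pred M) ℤ.+ δ M                        ≡⟨ increment-step x M ⟨
      x M                                       ≡⟨ xM ⟩
      + d                                       ∎
      where open ℤP.≤-Reasoning

  increment-nonneg : ∀ j → 1 ≤ j → j ≤ M → 0ℤ ℤ.≤ δ j
  increment-nonneg j 1≤j j≤M =
    ℤP.≤-trans (first-increment-nonneg (ℕP.≤-trans 1≤j j≤M)) (increments-rise 1 j ℕP.≤-refl 1≤j j≤M)

  increment-≤1 : ∀ j → 1 ≤ j → j ≤ M → δ j ℤ.≤ + 1
  increment-≤1 j 1≤j j≤M =
    ℤP.≤-trans (increments-rise j M 1≤j j≤M ℕP.≤-refl) (last-increment-≤1 (ℕP.≤-trans 1≤j j≤M))

  -- If the step after j is flat, x is 0 up to j, and d ≤ M - j since x rises by ≤ 1 per step.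
  flat-before : ∀ j → j < M → δ (suc j) ≡ 0ℤ → x j ≡ + (d ∸ (M ∸ j))
  flat-before j j<M δ≡0 = trans xj≡0 (cong +_ (sym (ℕP.m≤n⇒m∸n≡0 (ℤP.drop‿+≤+ d≤M∸j))))
    where
    before-nonneg : ∀ i → 0 < i → i ≤ j → 0ℤ ℤ.≤ δ i
    before-nonneg i 0<i i≤j = increment-nonneg i 0<i (ℕP.≤-trans i≤j (ℕP.<⇒≤ j<M))
    before-nonpos : ∀ i → 0 < i → i ≤ j → δ i ℤ.≤ 0ℤ
    before-nonpos i 0<i i≤j = subst (δ i ℤ.≤_) δ≡0 (increments-rise i (suc j) 0<i (ℕP.m≤n⇒m≤1+n i≤j) j<M)
    after-≤1 : ∀ i → j < i → i ≤ j + (M ∸ j) → δ i ℤ.≤ + 1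
    after-≤1 i j<i i≤M = increment-≤1 i (ℕP.≤-trans (s≤s z≤n) j<i) (subst (i ≤_) (ℕP.m+[n∸m]≡n (ℕP.<⇒≤ j<M)) i≤M)
    xj≡0 : x j ≡ 0ℤ
    xj≡0 = ℤP.≤-antisym
      (ℤP.≤-trans (growth-≤ x 0 j 0ℤ before-nonpos) (ℤP.≤-reflexive (trans (no-growth (x 0) j) x0)))
      (ℤP.≤-trans (ℤP.≤-reflexive (sym (trans (no-growth (x 0) j) x0))) (growth-≥ x 0 j 0ℤ before-nonneg))
    d≤M∸j : + d ℤ.≤ + (M ∸ j)
    d≤M∸j = begin
      + d                              ≡⟨ trans (sym xM) (cong x (sym (ℕP.m+[n∸m]≡n (ℕP.<⇒≤ j<M)))) ⟩
      x (j + (M ∸ j))                  ≤⟨ growth-≤ x j (M ∸ j) (+ 1) after-≤1 ⟩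
      x j ℤ.+ + (M ∸ j) ℤ.* + 1        ≡⟨ unit-growth (x j) (M ∸ j) ⟩
      x j ℤ.+ + (M ∸ j)                ≡⟨ trans (cong (ℤ._+ + (M ∸ j)) xj≡0) (ℤP.+-identityˡ (+ (M ∸ j))) ⟩
      + (M ∸ j)                        ∎
      where open ℤP.≤-Reasoning

  -- If the step after j is a unit step, all later steps are, so x M = x j + (M - j).
  steep-after : ∀ j → j < M → δ (suc j) ≡ + 1 → x j ≡ + (d ∸ (M ∸ j))
  steep-after j j<M δ≡1 = begin
    x j                                 ≡⟨ recover-left (x j) (+ (M ∸ j)) ⟩
    (x j ℤ.+ + (M ∸ j)) ℤ.- + (M ∸ j)   ≡⟨ cong (ℤ._- + (M ∸ j)) (trans (sym total) xM) ⟩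
    + d ℤ.- + (M ∸ j)                   ≡⟨ +-minus (ℤP.drop‿+≤+ M∸j≤d) ⟩
    + (d ∸ (M ∸ j))                     ∎
    where
    open ≡-Reasoning
    recover-left : ∀ y K → y ≡ (y ℤ.+ K) ℤ.- K
    recover-left = solve-∀
    j+[M∸j]≡M = ℕP.m+[n∸m]≡n (ℕP.<⇒≤ j<M)
    in-range : ∀ i → j < i → i ≤ j + (M ∸ j) → i ≤ M
    in-range i _ i≤M = subst (i ≤_) j+[M∸j]≡M i≤M
    after-≥1 : ∀ i → j < i → i ≤ j + (M ∸ j) → + 1 ℤ.≤ δ i
    after-≥1 i j<i i≤M = subst (ℤ._≤ δ i) δ≡1 (increments-rise (suc j) i (s≤s z≤n) j<i (in-range i j<i i≤M))
    after-≤1 : ∀ i → j < i → i ≤ j + (M ∸ j) → δ i ℤ.≤ + 1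
    after-≤1 i j<i i≤M = increment-≤1 i (ℕP.≤-trans (s≤s z≤n) j<i) (in-range i j<i i≤M)
    total : x M ≡ x j ℤ.+ + (M ∸ j)
    total = subst (λ K → x K ≡ x j ℤ.+ + (M ∸ j)) j+[M∸j]≡M (ℤP.≤-antisym
      (ℤP.≤-trans (growth-≤ x j (M ∸ j) (+ 1) after-≤1) (ℤP.≤-reflexive (unit-growth (x j) (M ∸ j))))
      (ℤP.≤-trans (ℤP.≤-reflexive (sym (unit-growth (x j) (M ∸ j)))) (growth-≥ x j (M ∸ j) (+ 1) after-≥1)))
    xj-nonneg : 0ℤ ℤ.≤ x j
    xj-nonneg = ℤP.≤-trans (ℤP.≤-reflexive (sym (trans (no-growth (x 0) j) x0)))
      (growth-≥ x 0 j 0ℤ (λ i 0<i i≤j → increment-nonneg i 0<i (ℕP.≤-trans i≤j (ℕP.<⇒≤ j<M))))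
    M∸j≤d : + (M ∸ j) ℤ.≤ + d
    M∸j≤d = ℤP.≤-trans (ℤP.+-monoˡ-≤ (+ (M ∸ j)) xj-nonneg) (ℤP.≤-reflexive (trans (sym total) xM))

  staircase : ∀ j → j ≤ M → x j ≡ + (d ∸ (M ∸ j))
  staircase j j≤M with ℕP.m≤n⇒m<n∨m≡n j≤M
  ... | inj₂ refl rewrite ℕP.n∸n≡0 j = xM
  ... | inj₁ j<M with zero-or-one (δ (suc j)) (increment-nonneg (suc j) (s≤s z≤n) j<M) (increment-≤1 (suc j) (s≤s z≤n) j<M)
  ...   | inj₁ δ≡0 = flat-before j j<M δ≡0
  ...   | inj₂ δ≡1 = steep-after j j<M δ≡1

-- Writing x for its (truncated) coefficients, the coordinates of γ are the increments
-- of x; x vanishes at 0 and n and equals d at m.  The staircase lemma applies to x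
-- on [0,m] and to the reflected sequence j ↦ x (n ∸ j) on [0, n-m].
module Uniqueness (n m d : ℕ) (1≤m : 1 ≤ m) (m≤k : m ≤ n ∸ 1) (d≤m : d ≤ m) (d≤r : d ≤ n ∸ m)
  (c : ℕ → ℤ) (isGamma : IsGammaDB n m d c) where

  m<n : m < n
  m<n = <-from-≤∸1 1≤m m≤k

  x : ℕ → ℤ
  x = trunc (n ∸ 1) c

  x-steps : CoordinateCondition n m (increment x)
  x-steps a b 1≤a a<b b≤n side =
    subst ZeroOrNegOne (cong₂ ℤ._-_ (combination-coordinate (n ∸ 1) c a) (combination-coordinate (n ∸ 1) c b))
          (root⇒coordinate-condition n m (corootVec n c) (proj₂ isGamma) a b 1≤a a<b b≤n side)

  c-at-m : c m ≡ + d
  c-at-m with proj₁ isGamma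
  ... | q , qm≡0 , c≡ = begin
    c m                                            ≡⟨ c≡ m 1≤m m≤k ⟩
    (if m ℕ.≡ᵇ m then + d else 0ℤ) ℤ.+ q m          ≡⟨ cong₂ (λ b z → (if b then + d else 0ℤ) ℤ.+ z) (≡ᵇ-refl m) qm≡0 ⟩
    + d ℤ.+ 0ℤ                                     ≡⟨ ℤP.+-identityʳ (+ d) ⟩
    + d                                            ∎
    where open ≡-Reasoning

  x-at-m : x m ≡ + d
  x-at-m = trans (trunc-in (n ∸ 1) c m 1≤m m≤k) c-at-m

  x-at-n : x n ≡ 0ℤ
  x-at-n = trunc-out (n ∸ 1) c n (<-from-≤∸1 (ℕP.≤-trans 1≤m m≤k) ℕP.≤-refl)

  module Left = Staircase x m d d≤m refl x-at-m
    (λ a b 1≤a a<b b≤m → x-steps a b 1≤a a<b (ℕP.≤-trans b≤m (ℕP.<⇒≤ m<n)) (inj₁ b≤m))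

  y : ℕ → ℤ
  y j = x (n ∸ j)

  increment-reflected : ∀ j → 1 ≤ j → j ≤ n → increment y j ≡ ℤ.- increment x (suc (n ∸ j))
  increment-reflected j 1≤j j≤n = begin
    x (n ∸ j) ℤ.- x (n ∸ pred j)                ≡⟨ cong (λ z → x (n ∸ j) ℤ.- x z) (∸-pred 1≤j j≤n) ⟩
    x (n ∸ j) ℤ.- x (suc (n ∸ j))               ≡⟨ neg-minus (x (n ∸ j)) (x (suc (n ∸ j))) ⟩
    ℤ.- increment x (suc (n ∸ j))               ∎
    where open ≡-Reasoning

  y-steps : ∀ a b → 1 ≤ a → a < b → b ≤ n ∸ m → ZeroOrNegOne (increment y a ℤ.- increment y b)
  y-steps a b 1≤a a<b b≤r =
    subst ZeroOrNegOne reflect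
      (x-steps (suc (n ∸ b)) (suc (n ∸ a)) (s≤s z≤n) (s≤s (ℕP.∸-monoʳ-< a<b b≤n)) (ℕP.∸-monoʳ-< {n} {a} {0} 1≤a a≤n) (inj₂ m<a′))
    where
    b≤n = ℕP.≤-trans b≤r (ℕP.m∸n≤m n m)
    a≤n = ℕP.≤-trans (ℕP.<⇒≤ a<b) b≤n
    m<a′ : m < suc (n ∸ b)
    m<a′ = s≤s (subst (_≤ n ∸ b) (ℕP.m∸[m∸n]≡n (ℕP.<⇒≤ m<n)) (ℕP.∸-monoʳ-≤ n b≤r))
    swap-negations : ∀ p q → p ℤ.- q ≡ ℤ.- q ℤ.- ℤ.- p
    swap-negations = solve-∀
    reflect : increment x (suc (n ∸ b)) ℤ.- increment x (suc (n ∸ a)) ≡ increment y a ℤ.- increment y b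
    reflect = trans (swap-negations (increment x (suc (n ∸ b))) (increment x (suc (n ∸ a))))
      (sym (cong₂ ℤ._-_ (increment-reflected a 1≤a a≤n) (increment-reflected b (ℕP.≤-trans 1≤a (ℕP.<⇒≤ a<b)) b≤n)))

  module Right = Staircase y (n ∸ m) d d≤r x-at-n (trans (cong x (ℕP.m∸[m∸n]≡n (ℕP.<⇒≤ m<n))) x-at-m) y-steps

  coefficients : ∀ i → 1 ≤ i → i ≤ n ∸ 1 → c i ≡ dBexplicit m d i
  coefficients i 1≤i i≤k with i ≤? m
  ... | yes i≤m = begin
    c i                  ≡⟨ trunc-in (n ∸ 1) c i 1≤i i≤k ⟨
    x i                  ≡⟨ Left.staircase i i≤m ⟩
    + (d ∸ (m ∸ i))      ≡⟨ cong (λ z → + (d ∸ z)) (ℕP.m≤n⇒∣m-n∣≡n∸m i≤m) ⟨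
    dBexplicit m d i     ∎
    where open ≡-Reasoning
  ... | no  i≰m = begin
    c i                           ≡⟨ trunc-in (n ∸ 1) c i 1≤i i≤k ⟨
    x i                           ≡⟨ cong x (ℕP.m∸[m∸n]≡n i≤n) ⟨
    y (n ∸ i)                     ≡⟨ Right.staircase (n ∸ i) (ℕP.∸-monoʳ-≤ n m≤i) ⟩
    + (d ∸ ((n ∸ m) ∸ (n ∸ i)))   ≡⟨ cong (λ z → + (d ∸ z)) (reflected-distance n m≤i i≤n) ⟩
    + (d ∸ (i ∸ m))               ≡⟨ cong (λ z → + (d ∸ z)) (ℕP.m≤n⇒∣n-m∣≡n∸m m≤i) ⟨
    dBexplicit m d i              ∎
    where
    open ≡-Reasoning
    m≤i = ℕP.<⇒≤ (ℕP.≰⇒> i≰m)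
    i≤n = ℕP.≤-trans i≤k (ℕP.m∸n≤m n 1)
    reflected-distance : ∀ n {m i} → m ≤ i → i ≤ n → (n ∸ m) ∸ (n ∸ i) ≡ i ∸ m
    reflected-distance n       {zero}  _         i≤n       = ℕP.m∸[m∸n]≡n i≤n
    reflected-distance (suc n) {suc m} (s≤s m≤i) (s≤s i≤n) = reflected-distance n m≤i i≤n

s-left : ∀ i → s i i ≡ suc i
s-left i rewrite ≡ᵇ-refl i = refl

s-right : ∀ i → s i (suc i) ≡ i
s-right i rewrite ≡ᵇ-false (ℕP.1+n≢n {i}) | ≡ᵇ-refl i = refl

s-fix : ∀ i x → x ≢ i → x ≢ suc i → s i x ≡ x
s-fix i x x≢i x≢1+i rewrite ≡ᵇ-false x≢i | ≡ᵇ-false x≢1+i = refl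

prodS-++ : ∀ xs ys x → prodS (xs ++ ys) x ≡ prodS xs (prodS ys x)
prodS-++ []       ys x = refl
prodS-++ (i ∷ xs) ys x = cong (s i) (prodS-++ xs ys x)

-- cycle i k = s_i s_{i+1} ⋯ s_{i+k-1}: shifts [i, i+k) up by one and sends i+k to i.
cycle : ℕ → ℕ → List ℕ
cycle i zero    = []
cycle i (suc k) = i ∷ cycle (suc i) k

cycle-below : ∀ i k x → x < i → prodS (cycle i k) x ≡ x
cycle-below i zero    x x<i = refl
cycle-below i (suc k) x x<i rewrite cycle-below (suc i) k x (ℕP.m<n⇒m<1+n x<i) =
  s-fix i x (ℕP.<⇒≢ x<i) (ℕP.<⇒≢ (ℕP.m<n⇒m<1+n x<i))

cycle-above : ∀ i k x → i + k < x → prodS (cycle i k) x ≡ x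
cycle-above i zero    x i<x = refl
cycle-above i (suc k) x i+k<x rewrite cycle-above (suc i) k x (subst (_< x) (ℕP.+-suc i k) i+k<x) =
  s-fix i x (ℕP.>⇒≢ (ℕP.≤-<-trans (ℕP.m≤m+n i (suc k)) i+k<x))
            (ℕP.>⇒≢ (ℕP.≤-<-trans (subst (suc i ≤_) (sym (ℕP.+-suc i k)) (s≤s (ℕP.m≤m+n i k))) i+k<x))

cycle-shift : ∀ i k x → i ≤ x → x < i + k → prodS (cycle i k) x ≡ suc x
cycle-shift i zero    x i≤x x<i+0 = ⊥-elim (ℕP.<⇒≱ (subst (x <_) (ℕP.+-identityʳ i) x<i+0) i≤x)
cycle-shift i (suc k) x i≤x x<i+k with ℕP.m≤n⇒m<n∨m≡n i≤x
... | inj₂ refl rewrite cycle-below (suc i) k i (ℕP.n<1+n i) = s-left i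
... | inj₁ i<x rewrite cycle-shift (suc i) k x i<x (subst (x <_) (ℕP.+-suc i k) x<i+k) =
  s-fix i (suc x) (ℕP.>⇒≢ (ℕP.m<n⇒m<1+n i<x)) (ℕP.>⇒≢ (s≤s i<x))

cycle-top : ∀ i k → prodS (cycle i k) (i + k) ≡ i
cycle-top i zero    = ℕP.+-identityʳ i
cycle-top i (suc k) rewrite ℕP.+-suc i k = trans (cong (s i) (cycle-top (suc i) k)) (s-right i)

-- reversalWord i k: a word for the reversal of the interval [i, i+k], built as
-- (reversal of [i+1, i+k]) · cycle i (k+1).
reversalWord : ℕ → ℕ → List ℕ
reversalWord i zero    = []
reversalWord i (suc k) = reversalWord (suc i) k ++ cycle i (suc k)

reversal-outside : ∀ i k x → (x < i) ⊎ (i + k < x) → prodS (reversalWord i k) x ≡ x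
reversal-outside i zero    x _ = refl
reversal-outside i (suc k) x (inj₁ x<i)
  rewrite prodS-++ (reversalWord (suc i) k) (cycle i (suc k)) x | cycle-below i (suc k) x x<i =
  reversal-outside (suc i) k x (inj₁ (ℕP.m<n⇒m<1+n x<i))
reversal-outside i (suc k) x (inj₂ i+k<x)
  rewrite prodS-++ (reversalWord (suc i) k) (cycle i (suc k)) x | cycle-above i (suc k) x i+k<x =
  reversal-outside (suc i) k x (inj₂ (subst (_< x) (ℕP.+-suc i k) i+k<x))

reversal-inside : ∀ i k x → i ≤ x → x ≤ i + k → prodS (reversalWord i k) x + x ≡ i + (i + k)
reversal-inside i zero    x i≤x x≤i+0 rewrite ℕP.+-identityʳ i | ℕP.≤-antisym x≤i+0 i≤x = refl
reversal-inside i (suc k) x i≤x x≤i+k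
  rewrite prodS-++ (reversalWord (suc i) k) (cycle i (suc k)) x with ℕP.m≤n⇒m<n∨m≡n x≤i+k
... | inj₂ refl rewrite cycle-top i (suc k) | reversal-outside (suc i) k i (inj₁ (ℕP.n<1+n i)) = refl
... | inj₁ x<i+k rewrite cycle-shift i (suc k) x i≤x x<i+k = ℕP.suc-injective (begin
  suc (prodS (reversalWord (suc i) k) (suc x) + x) ≡⟨ ℕP.+-suc _ x ⟨
  prodS (reversalWord (suc i) k) (suc x) + suc x   ≡⟨ reversal-inside (suc i) k (suc x) (s≤s i≤x) (subst (suc x ≤_) (ℕP.+-suc i k) x<i+k) ⟩
  suc i + (suc i + k)                              ≡⟨ regroup i k ⟩
  suc (i + (i + suc k))                            ∎)
  where
  open ≡-Reasoning
  regroup : ∀ i k → suc i + (suc i + k) ≡ suc (i + (i + suc k))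
  regroup = ℕSolver.solve-∀

Between : ℕ → ℕ → ℕ → Set
Between i k e = (i ≤ e) × (e < i + k)

Between-widen : ∀ i k {e} → Between (suc i) k e → Between i (suc k) e
Between-widen i k {e} (i<e , e<i+k) = ℕP.<⇒≤ i<e , subst (e <_) (sym (ℕP.+-suc i k)) e<i+k

cycle-letters : ∀ i k → All (Between i k) (cycle i k)
cycle-letters i zero    = []
cycle-letters i (suc k) = (ℕP.≤-refl , ℕP.m<m+n i (s≤s z≤n)) ∷ All.map (Between-widen i k) (cycle-letters (suc i) k)

reversal-letters : ∀ i k → All (Between i k) (reversalWord i k)
reversal-letters i zero    = []
reversal-letters i (suc k) = ++⁺ (All.map (Between-widen i k) (reversal-letters (suc i) k)) (cycle-letters i (suc k))

w0P≗reversal : ∀ i j → w0P i j ≗P prodS (reversalWord i (suc j ∸ i))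
w0P≗reversal i j x with i ≤? j
... | no  i≰j rewrite ≤ᵇ-false i≰j | ℕP.m≤n⇒m∸n≡0 (ℕP.≰⇒> i≰j) = refl
... | yes i≤j rewrite ≤ᵇ-true i≤j with x <? i | suc j <? x
...   | yes x<i | _       rewrite ≤ᵇ-false (ℕP.<⇒≱ x<i) = sym (reversal-outside i (suc j ∸ i) x (inj₁ x<i))
...   | no  x≮i | yes j<x rewrite ≤ᵇ-true (ℕP.≮⇒≥ x≮i) | ≤ᵇ-false (ℕP.<⇒≱ j<x) =
  sym (reversal-outside i (suc j ∸ i) x (inj₂ (subst (_< x) (sym i+[1+j∸i]≡1+j) j<x)))
  where
  i+[1+j∸i]≡1+j = ℕP.m+[n∸m]≡n (ℕP.m≤n⇒m≤1+n i≤j)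
...   | no  x≮i | no  x≯j rewrite ≤ᵇ-true (ℕP.≮⇒≥ x≮i) | ≤ᵇ-true (ℕP.≮⇒≥ x≯j) = begin
  i + suc j ∸ x                                         ≡⟨ cong (_∸ x) (sym reversed) ⟩
  prodS (reversalWord i (suc j ∸ i)) x + x ∸ x          ≡⟨ ℕP.m+n∸n≡m _ x ⟩
  prodS (reversalWord i (suc j ∸ i)) x                  ∎
  where
  open ≡-Reasoning
  reversed : prodS (reversalWord i (suc j ∸ i)) x + x ≡ i + suc j
  reversed = trans (reversal-inside i (suc j ∸ i) x (ℕP.≮⇒≥ x≮i)
                     (subst (x ≤_) (sym (ℕP.m+[n∸m]≡n (ℕP.m≤n⇒m≤1+n i≤j))) (ℕP.≮⇒≥ x≯j)))
                   (cong (λ z → i + z) (ℕP.m+[n∸m]≡n (ℕP.m≤n⇒m≤1+n i≤j)))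

blockWord : ℕ → ℕ → List ℕ
blockWord t t' = reversalWord (suc t) (t' ∸ suc t)

block-end : ∀ {t t'} → t < t' → suc t + (t' ∸ suc t) ≡ t'
block-end = ℕP.m+[n∸m]≡n

w0P≗block : ∀ t t' → w0P (t + 1) (t' ∸ 1) ≗P prodS (blockWord t t')
w0P≗block t t' x rewrite ℕP.+-comm t 1 =
  trans (w0P≗reversal (suc t) (t' ∸ 1) x) (cong (λ k → prodS (reversalWord (suc t) k) x) (block-length t'))
  where
  block-length : ∀ t' → suc (t' ∸ 1) ∸ suc t ≡ t' ∸ suc t
  block-length zero     = ℕP.0∸n≡0 t
  block-length (suc t') = refl

block-outside : ∀ t t' x → t ≤ t' → (x ≤ t) ⊎ (t' < x) → prodS (blockWord t t') x ≡ x
block-outside t t' x t≤t' (inj₁ x≤t) = reversal-outside (suc t) (t' ∸ suc t) x (inj₁ (s≤s x≤t))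
block-outside t t' x t≤t' (inj₂ t'<x) with ℕP.m≤n⇒m<n∨m≡n t≤t'
... | inj₁ t<t' = reversal-outside (suc t) (t' ∸ suc t) x (inj₂ (subst (_< x) (sym (block-end t<t')) t'<x))
... | inj₂ refl rewrite ℕP.m≤n⇒m∸n≡0 (ℕP.n≤1+n t) = refl

block-inside : ∀ t t' x → t < x → x ≤ t' → prodS (blockWord t t') x + x ≡ suc t + t'
block-inside t t' x t<x x≤t' =
  trans (reversal-inside (suc t) (t' ∸ suc t) x t<x (subst (x ≤_) (sym (block-end t<t')) x≤t'))
        (cong (λ z → suc t + z) (block-end t<t'))
  where
  t<t' = ℕP.<-≤-trans t<x x≤t'

block-range : ∀ t t' x → t < x → x ≤ t' → (t < prodS (blockWord t t') x) × (prodS (blockWord t t') x ≤ t')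
block-range t t' x t<x x≤t' =
  ℕP.+-cancelʳ-≤ x (suc t) y (subst (suc t + x ≤_) (sym (block-inside t t' x t<x x≤t')) (ℕP.+-monoʳ-≤ (suc t) x≤t')) ,
  ℕP.+-cancelʳ-≤ x y t' (subst (_≤ t' + x) (sym (block-inside t t' x t<x x≤t'))
                            (subst (_≤ t' + x) (ℕP.+-comm t' (suc t)) (ℕP.+-monoʳ-≤ t' t<x)))
  where
  y = prodS (blockWord t t') x

block-letters : ∀ t t' → t ≤ t' → All (λ e → (t < e) × (e < t')) (blockWord t t')
block-letters t t' t≤t' = All.map inside (reversal-letters (suc t) (t' ∸ suc t))
  where
  inside : ∀ {e} → Between (suc t) (t' ∸ suc t) e → (t < e) × (e < t')
  inside {e} (t<e , e<end) with ℕP.m≤n⇒m<n∨m≡n t≤t'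
  ... | inj₁ t<t' = t<e , subst (e <_) (block-end t<t') e<end
  ... | inj₂ refl = ⊥-elim (ℕP.<⇒≱ e<end (ℕP.≤-trans (ℕP.≤-reflexive empty-block) t<e))
    where
    empty-block : suc t + (t ∸ suc t) ≡ suc t
    empty-block = trans (cong (λ z → suc t + z) (ℕP.m≤n⇒m∸n≡0 (ℕP.n≤1+n t))) (ℕP.+-identityʳ (suc t))

inversion-count-mono : ∀ {P Q : Set} → (P → Q) → (p? : Dec P) (q? : Dec Q) →
  (if does p? then 1 else 0) ≤ (if does q? then 1 else 0)
inversion-count-mono P⇒Q (no _)  q?    = z≤n
inversion-count-mono P⇒Q (yes p) q? rewrite dec-true q? (P⇒Q p) = ℕP.≤-refl

longest-by-inversions : ∀ n J w → InW J w →
  (∀ v → InW J v → ∀ a b → 1 ≤ a → a < b → b ≤ n → v b < v a → w b < w a) → IsLongest n J w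
longest-by-inversions n J w w∈W inherits = w∈W , fewer-inversions
  where
  fewer-inversions : ∀ v → InW J v → len n v ≤ len n w
  fewer-inversions v v∈W = sumℕ-mono n _ _ λ b 1≤b b≤n → sumℕ-mono (b ∸ 1) _ _ λ a 1≤a a≤b-1 →
    inversion-count-mono (inherits v v∈W a b 1≤a (below b 1≤b a≤b-1) b≤n) (v b ℕ.<? v a) (w b ℕ.<? w a)
    where
    below : ∀ {a} b → 1 ≤ b → a ≤ b ∸ 1 → a < b
    below (suc b) _ a≤b = s≤s a≤b

module Levels (J : ℕ → Set) (β : ℕ → ℕ) (β-mono : ∀ {x y} → x ≤ y → β x ≤ β y)
  (β-s : ∀ i → J i → ∀ x → β (s i x) ≡ β x) where

  β-word : ∀ is → All J is → ∀ x → β (prodS is x) ≡ β x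
  β-word []       []         x = refl
  β-word (i ∷ is) (Ji ∷ Jis) x = trans (β-s i Ji (prodS is x)) (β-word is Jis x)

  inversion-within-level : ∀ v → InW J v → ∀ {a b} → a < b → v b < v a → β a ≡ β b
  inversion-within-level v (is , Jis , v≗) {a} {b} a<b vb<va = ℕP.≤-antisym (β-mono (ℕP.<⇒≤ a<b)) (begin
    β b           ≡⟨ trans (cong β (v≗ b)) (β-word is Jis b) ⟨
    β (v b)       ≤⟨ β-mono (ℕP.<⇒≤ vb<va) ⟩
    β (v a)       ≡⟨ trans (cong β (v≗ a)) (β-word is Jis a) ⟩
    β a           ∎)
    where open ℕP.≤-Reasoning

above : ℕ → ℕ → ℕ
above t x = if t ℕ.<ᵇ x then 1 else 0

above-yes : ∀ {t x} → t < x → above t x ≡ 1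
above-yes t<x rewrite <ᵇ-true t<x = refl

above-no : ∀ {t x} → x ≤ t → above t x ≡ 0
above-no x≤t rewrite <ᵇ-false (ℕP.≤⇒≯ x≤t) = refl

above-step : ∀ t i → t ≢ i → above t (suc i) ≡ above t i
above-step t i t≢i with t <? i
... | yes t<i = trans (above-yes (ℕP.m<n⇒m<1+n t<i)) (sym (above-yes t<i))
... | no  t≮i = trans (above-no (ℕP.≤∧≢⇒< (ℕP.≮⇒≥ t≮i) (λ i≡t → t≢i (sym i≡t)))) (sym (above-no (ℕP.≮⇒≥ t≮i)))

above-mono : ∀ t {x y} → x ≤ y → above t x ≤ above t y
above-mono t {x} {y} x≤y with t <? x
... | yes t<x rewrite above-yes t<x | above-yes {t} {y} (ℕP.<-≤-trans t<x x≤y) = ℕP.≤-refl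
... | no  t≮x rewrite above-no {t} {x} (ℕP.≮⇒≥ t≮x) = z≤n

-- The longest element of W_J for J = [1, n-1] ∖ {t₁, t₂, t₃} is the product of the
-- reversals of the four blocks (0,t₁], (t₁,t₂], (t₂,t₃], (t₃,n]: generators of W_J
-- preserve the block of every position, and w reverses each block.
module FourBlocks (n t₁ t₂ t₃ : ℕ) (t₁≤t₂ : t₁ ≤ t₂) (t₂≤t₃ : t₂ ≤ t₃) (t₃≤n : t₃ ≤ n) (J : ℕ → Set)
  (J-complete : ∀ e → 1 ≤ e → e ≤ n ∸ 1 → e ≢ t₁ → e ≢ t₂ → e ≢ t₃ → J e)
  (J-sound : ∀ e → J e → (e ≢ t₁) × (e ≢ t₂) × (e ≢ t₃)) where

  w : Perm
  w = w0P 1 (t₁ ∸ 1) · (w0P (t₁ + 1) (t₂ ∸ 1) · (w0P (t₂ + 1) (t₃ ∸ 1) · w0P (t₃ + 1) (n ∸ 1)))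

  B : ℕ → ℕ → Perm
  B t t' = prodS (blockWord t t')

  w≗blocks : ∀ x → w x ≡ B 0 t₁ (B t₁ t₂ (B t₂ t₃ (B t₃ n x)))
  w≗blocks x =
    trans (w0P≗block 0 t₁ _) (cong (B 0 t₁) (trans (w0P≗block t₁ t₂ _) (cong (B t₁ t₂)
      (trans (w0P≗block t₂ t₃ _) (cong (B t₂ t₃) (w0P≗block t₃ n x))))))

  word : List ℕ
  word = blockWord 0 t₁ ++ (blockWord t₁ t₂ ++ (blockWord t₂ t₃ ++ blockWord t₃ n))

  word≗blocks : ∀ x → prodS word x ≡ B 0 t₁ (B t₁ t₂ (B t₂ t₃ (B t₃ n x)))
  word≗blocks x =
    trans (prodS-++ (blockWord 0 t₁) _ x) (cong (B 0 t₁) (trans (prodS-++ (blockWord t₁ t₂) _ x)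
      (cong (B t₁ t₂) (prodS-++ (blockWord t₂ t₃) (blockWord t₃ n) x))))

  t₁≤t₃ = ℕP.≤-trans t₁≤t₂ t₂≤t₃

  block-in-J : ∀ t t' → t ≤ t' → t' ≤ n → (∀ {e} → t < e → e < t' → (e ≢ t₁) × (e ≢ t₂) × (e ≢ t₃)) →
    All J (blockWord t t')
  block-in-J t t' t≤t' t'≤n not-cut = All.map in-J (block-letters t t' t≤t')
    where
    in-J : ∀ {e} → (t < e) × (e < t') → J e
    in-J {e} (t<e , e<t') with not-cut t<e e<t'
    ... | e≢t₁ , e≢t₂ , e≢t₃ = J-complete e (ℕP.≤-trans (s≤s z≤n) t<e)
      (ℕP.≤-trans (ℕP.<⇒≤pred (ℕP.<-≤-trans e<t' t'≤n)) (ℕP.≤-reflexive (pred≡∸1 n))) e≢t₁ e≢t₂ e≢t₃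
      where
      pred≡∸1 : ∀ n → pred n ≡ n ∸ 1
      pred≡∸1 zero    = refl
      pred≡∸1 (suc n) = refl

  w∈W : InW J w
  w∈W = word , letters , λ x → trans (w≗blocks x) (sym (word≗blocks x))
    where
    left : ∀ {u e} → u < e → e ≢ u
    left = ℕP.>⇒≢
    right : ∀ {u t' e} → t' ≤ u → e < t' → e ≢ u
    right t'≤u e<t' = ℕP.<⇒≢ (ℕP.<-≤-trans e<t' t'≤u)
    letters : All J word
    letters =
      ++⁺ (block-in-J 0 t₁ z≤n (ℕP.≤-trans t₁≤t₃ t₃≤n) λ _ e<t₁ → right ℕP.≤-refl e<t₁ , right t₁≤t₂ e<t₁ , right t₁≤t₃ e<t₁)
     (++⁺ (block-in-J t₁ t₂ t₁≤t₂ (ℕP.≤-trans t₂≤t₃ t₃≤n) λ t₁<e e<t₂ → left t₁<e , right ℕP.≤-refl e<t₂ , right t₂≤t₃ e<t₂)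
     (++⁺ (block-in-J t₂ t₃ t₂≤t₃ t₃≤n λ t₂<e e<t₃ → left (ℕP.≤-<-trans t₁≤t₂ t₂<e) , left t₂<e , right ℕP.≤-refl e<t₃)
          (block-in-J t₃ n t₃≤n ℕP.≤-refl λ t₃<e _ → left (ℕP.≤-<-trans t₁≤t₃ t₃<e) , left (ℕP.≤-<-trans t₂≤t₃ t₃<e) , left t₃<e)))

  -- The block of x, counted by the cut points below it.
  level : ℕ → ℕ
  level x = above t₁ x + above t₂ x + above t₃ x

  level-mono : ∀ {x y} → x ≤ y → level x ≤ level y
  level-mono x≤y = ℕP.+-mono-≤ (ℕP.+-mono-≤ (above-mono t₁ x≤y) (above-mono t₂ x≤y)) (above-mono t₃ x≤y)

  level-s : ∀ i → J i → ∀ x → level (s i x) ≡ level x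
  level-s i Ji x with J-sound i Ji | x ≟ i
  ... | i≢t₁ , i≢t₂ , i≢t₃ | yes refl rewrite s-left x
    | above-step t₁ x (λ t≡x → i≢t₁ (sym t≡x)) | above-step t₂ x (λ t≡x → i≢t₂ (sym t≡x))
    | above-step t₃ x (λ t≡x → i≢t₃ (sym t≡x)) = refl
  ... | i≢t₁ , i≢t₂ , i≢t₃ | no x≢i with x ≟ suc i
  ...   | yes refl rewrite s-right i
    | above-step t₁ i (λ t≡i → i≢t₁ (sym t≡i)) | above-step t₂ i (λ t≡i → i≢t₂ (sym t≡i))
    | above-step t₃ i (λ t≡i → i≢t₃ (sym t≡i)) = refl
  ...   | no x≢1+i rewrite s-fix i x x≢i x≢1+i = refl

  open Levels J level level-mono level-s

  -- w x + x is the sum of the endpoints of the block containing x.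
  endpoint-sum : ℕ → ℕ
  endpoint-sum 0 = 1 + t₁
  endpoint-sum 1 = suc t₁ + t₂
  endpoint-sum 2 = suc t₂ + t₃
  endpoint-sum _ = suc t₃ + n

  w-on-blocks : ∀ x → 1 ≤ x → x ≤ n → w x + x ≡ endpoint-sum (level x)
  w-on-blocks x 1≤x x≤n rewrite w≗blocks x with x ≤? t₁
  ... | yes x≤t₁
    rewrite above-no {t₁} x≤t₁ | above-no {t₂} (ℕP.≤-trans x≤t₁ t₁≤t₂) | above-no {t₃} (ℕP.≤-trans x≤t₁ t₁≤t₃)
          | block-outside t₃ n x t₃≤n (inj₁ (ℕP.≤-trans x≤t₁ t₁≤t₃)) | block-outside t₂ t₃ x t₂≤t₃ (inj₁ (ℕP.≤-trans x≤t₁ t₁≤t₂))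
          | block-outside t₁ t₂ x t₁≤t₂ (inj₁ x≤t₁) = block-inside 0 t₁ x 1≤x x≤t₁
  ... | no x≰t₁ with x ≤? t₂
  ...   | yes x≤t₂
    rewrite above-yes {t₁} (ℕP.≰⇒> x≰t₁) | above-no {t₂} x≤t₂ | above-no {t₃} (ℕP.≤-trans x≤t₂ t₂≤t₃)
          | block-outside t₃ n x t₃≤n (inj₁ (ℕP.≤-trans x≤t₂ t₂≤t₃)) | block-outside t₂ t₃ x t₂≤t₃ (inj₁ x≤t₂)
          | block-outside 0 t₁ (B t₁ t₂ x) z≤n (inj₂ (proj₁ (block-range t₁ t₂ x (ℕP.≰⇒> x≰t₁) x≤t₂)))
          = block-inside t₁ t₂ x (ℕP.≰⇒> x≰t₁) x≤t₂
  ...   | no x≰t₂ with x ≤? t₃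
  ...     | yes x≤t₃
    rewrite above-yes {t₁} (ℕP.≤-<-trans t₁≤t₂ (ℕP.≰⇒> x≰t₂)) | above-yes {t₂} (ℕP.≰⇒> x≰t₂) | above-no {t₃} x≤t₃
          | block-outside t₃ n x t₃≤n (inj₁ x≤t₃)
          | block-outside t₁ t₂ (B t₂ t₃ x) t₁≤t₂ (inj₂ (proj₁ (block-range t₂ t₃ x (ℕP.≰⇒> x≰t₂) x≤t₃)))
          | block-outside 0 t₁ (B t₂ t₃ x) z≤n (inj₂ (ℕP.≤-<-trans t₁≤t₂ (proj₁ (block-range t₂ t₃ x (ℕP.≰⇒> x≰t₂) x≤t₃))))
          = block-inside t₂ t₃ x (ℕP.≰⇒> x≰t₂) x≤t₃
  ...     | no x≰t₃
    rewrite above-yes {t₁} (ℕP.≤-<-trans t₁≤t₃ (ℕP.≰⇒> x≰t₃)) | above-yes {t₂} (ℕP.≤-<-trans t₂≤t₃ (ℕP.≰⇒> x≰t₃))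
          | above-yes {t₃} (ℕP.≰⇒> x≰t₃)
          | block-outside t₂ t₃ (B t₃ n x) t₂≤t₃ (inj₂ (proj₁ (block-range t₃ n x (ℕP.≰⇒> x≰t₃) x≤n)))
          | block-outside t₁ t₂ (B t₃ n x) t₁≤t₂ (inj₂ (ℕP.≤-<-trans t₂≤t₃ (proj₁ (block-range t₃ n x (ℕP.≰⇒> x≰t₃) x≤n))))
          | block-outside 0 t₁ (B t₃ n x) z≤n (inj₂ (ℕP.≤-<-trans t₁≤t₃ (proj₁ (block-range t₃ n x (ℕP.≰⇒> x≰t₃) x≤n))))
          = block-inside t₃ n x (ℕP.≰⇒> x≰t₃) x≤n

  reversed-within-level : ∀ a b → 1 ≤ a → a < b → b ≤ n → level a ≡ level b → w b < w a
  reversed-within-level a b 1≤a a<b b≤n same-level = ℕP.≰⇒> λ wa≤wb → ℕP.<-irrefl sums≡ (ℕP.+-mono-≤-< wa≤wb a<b)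
    where
    sums≡ : w a + a ≡ w b + b
    sums≡ = trans (w-on-blocks a 1≤a (ℕP.≤-trans (ℕP.<⇒≤ a<b) b≤n))
             (trans (cong endpoint-sum same-level) (sym (w-on-blocks b (ℕP.≤-trans 1≤a (ℕP.<⇒≤ a<b)) b≤n)))

  longest : IsLongest n J w
  longest = longest-by-inversions n J w w∈W λ v v∈W a b 1≤a a<b b≤n vb<va →
    reversed-within-level a b 1≤a a<b b≤n (inversion-within-level v v∈W a<b vb<va)

proposition3p3 : (n m d : ℕ) → 1 ≤ m → m ≤ n ∸ 1 → d ≤ m → d ≤ n ∸ m →
    IsGammaDB n m d (dBexplicit m d) ×
    (∀ c → IsGammaDB n m d c → ∀ i → 1 ≤ i → i ≤ n ∸ 1 → c i ≡ dBexplicit m d i) ×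
    (∀ i → 1 ≤ i → i ≤ n ∸ 1 →
      (InΔP' n m (dBexplicit m d) i ⇔ ((i ≢ m ∸ d) × (i ≢ m) × (i ≢ m + d)))) ×
    IsLongest n (InΔP' n m (dBexplicit m d))
      (w0P 1 (m ∸ d ∸ 1) · (w0P (m ∸ d + 1) (m ∸ 1) ·
        (w0P (m + 1) (m + d ∸ 1) · w0P (m + d + 1) (n ∸ 1))))
proposition3p3 n m d 1≤m m≤k d≤m d≤r =
  isGammaDB ,
  (λ c isGamma → Uniqueness.coefficients n m d 1≤m m≤k d≤m d≤r c isGamma) ,
  ΔP′-characterisation ,
  FourBlocks.longest n (m ∸ d) m (m + d) (ℕP.m∸n≤m m d) (ℕP.m≤m+n m d) m+d≤n (InΔP' n m (dBexplicit m d))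
    (λ e 1≤e e≤k e≢m∸d e≢m e≢m+d → Equivalence.from (ΔP′-characterisation e 1≤e e≤k) (e≢m∸d , e≢m , e≢m+d))
    (λ e e∈ΔP′ → Equivalence.to (ΔP′-characterisation e (proj₁ e∈ΔP′) (proj₁ (proj₂ e∈ΔP′))) e∈ΔP′)
  where
  open Tent n m d 1≤m m≤k d≤m d≤r
  m+d≤n : m + d ≤ n
  m+d≤n = subst (m + d ≤_) (ℕP.m+[n∸m]≡n (ℕP.<⇒≤ m<n)) (ℕP.+-monoʳ-≤ m d≤r)
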